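{- Let $p$ be a prime, $K$ a field of characteristic $p$, $n\geq2$ an integer, $r=n-1$, and $f\in K^\times$. Let $A=K[t]/(t^{p^n})$ with the Hopf algebra structure given by $\Delta(t)=t\otimes1+1\otimes t+f\sum_{\ell=1}^{p-1}\frac{1}{\ell!(p-\ell)!}t^{p^{r}\ell}\otimes t^{p^{r}(p-\ell)}$, $\varepsilon(t)=0$, $\lambda(t)=-t$, let $H=\operatorname{Hom}_K(A,K)$ be its dual Hopf algebra, and for $0\le j\le p^n-1$ let $z_j\in H$ be defined by $z_j(t^i)=\delta_{i,j}$; thus $H=K[z_{p},\dots,z_{p^{r}}]/(z_{p}^{p},\dots,z_{p^{r-1}}^{p},z_{p^{r}}^{p^{2}})$ with $\Delta(z_{p^s})=\sum_{i=0}^{p^s}z_{p^s-i}\otimes z_i$. Let $L=K(x)$ be a field extension of degree $p^n$ with $x^{p^n}\in K$, and let $\alpha:L\to L\otimes_K A$ be the $K$-algebra homomorphism with \[ \alpha(x)=x\otimes1+1\otimes t+f\sum_{\ell=1}^{p-1}\frac{1}{\ell!(p-\ell)!}x^{p^{r}\ell}\otimes t^{p^{r}(p-\ell)}, \] and let $H$ act on $L$ by $h(y)=\operatorname{mult}(1\otimes h)\alpha(y)$. For $0\leq i\leq p^{n}-1$ write $i=\sum_{\ell=0}^{r}i_{(\ell)}p^{\ell}$ with $0\le i_{(\ell)}\le p-1$. Then for $0\leq s\leq r-1$, \[ z_{p^{s}}(x^{i})=i_{(s)}x^{i-p^{s}}, \] and \[ z_{p^{r}}(x^{i})=i_{(r)}x^{i-p^{r}}-i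 f x^{p^{r}(p-1)+i-1}. \]
   Context: $\delta_{i,j}$ is the Kronecker delta. The coefficients $1/(\ell!(p-\ell)!)$ are interpreted in $\mathbb{F}_p\subseteq K$, and integers such as $i_{(s)}$ and $i$ are read in $\mathbb{F}_p\subseteq K$. Negative powers of $x$ are taken in the field $L$. The dual $H$ has multiplication $(\phi\psi)(h)=\operatorname{mult}(\phi\otimes\psi)\Delta(h)$ and comultiplication determined by $\Delta(\phi)(a\otimes b)=\phi(ab)$. -}

module Defs where

open import Level using (_⊔_)
open import Algebra.Bundles using (CommutativeRing)
open import Data.Bool using (if_then_else_)
open import Data.Nat as ℕ using (ℕ; zero; suc; _^_; _∸_; _≡ᵇ_; _!)
open import Data.Nat.DivMod using (_/_; _%_)
open import Data.Fin using (Fin; toℕ)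
open import Data.Integer as ℤ using (ℤ; +_; -[1+_])
open import Data.Product using (_×_; ∃)
open import Relation.Nullary using (¬_)

-- base-p digit i_(s) of i  (p = 0 never occurs, p is prime)
digit : ℕ → ℕ → ℕ → ℕ
digit zero    i s       = 0
digit (suc q) i zero    = i % suc q
digit (suc q) i (suc s) = digit (suc q) (i / suc q) s

sumFin : ∀ {b} {X : Set b} → X → (X → X → X) → (m : ℕ) → (Fin m → X) → X
sumFin z _⊕_ zero    g = z
sumFin z _⊕_ (suc m) g = g Fin.zero ⊕ sumFin z _⊕_ m (λ k → g (Fin.suc k))

sumRange : ∀ {b} {X : Set b} → X → (X → X → X) → ℕ → ℕ → (ℕ → X) → X
sumRange {X = X} z _⊕_ lo hi g = go (suc hi ∸ lo) lo
  where
  go : ℕ → ℕ → X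
  go zero    _ = z
  go (suc m) l = g l ⊕ go m (suc l)

module _ {a ℓ} (K : CommutativeRing a ℓ) where
  open CommutativeRing K

  IsField : Set (a ⊔ ℓ)
  IsField = (¬ 1# ≈ 0#) × (∀ u → ¬ u ≈ 0# → ∃ λ v → u * v ≈ 1#)

  ℕ→K : ℕ → Carrier
  ℕ→K zero    = 0#
  ℕ→K (suc m) = 1# + ℕ→K m

  -- L = K[X]/(X^N - c)  (basis 1, x, …, x^(N-1), with x^N = c ∈ K),
  -- A = K[t]/(t^N),  L ⊗_K A  with basis x^a ⊗ t^b.
  module Ext (N : ℕ) (c : Carrier) where

    ΣK : (m : ℕ) → (Fin m → Carrier) → Carrier
    ΣK = sumFin 0# _+_

    L : Set a
    L = Fin N → Carrier

    _≈L_ : L → L → Set ℓ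
    u ≈L v = ∀ k → u k ≈ v k

    0L : L
    0L _ = 0#

    eL : ℕ → L
    eL m k = if toℕ k ≡ᵇ m then 1# else 0#

    1L : L
    1L = eL 0

    _+L_ : L → L → L
    (u +L v) k = u k + v k

    -L_ : L → L
    (-L u) k = - (u k)

    _-L_ : L → L → L
    u -L v = u +L (-L v)

    scale : Carrier → L → L
    scale λ' u k = λ' * u k

    _*L_ : L → L → L
    (u *L v) k = ΣK N λ i → ΣK N λ j →
      let s = toℕ i ℕ.+ toℕ j in
      if s ≡ᵇ toℕ k then u i * v j
      else if s ≡ᵇ (toℕ k ℕ.+ N) then c * (u i * v j)
      else 0#

    powL : L → ℕ → L
    powL u zero    = 1L
    powL u (suc m) = u *L powL u m

    ΣL : (m : ℕ) → (Fin m → L) → L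
    ΣL = sumFin 0L _+L_

    LIsField : Set (a ⊔ ℓ)
    LIsField = (¬ 1L ≈L 0L) × (∀ u → ¬ u ≈L 0L → ∃ λ v → (u *L v) ≈L 1L)

    A : Set a
    A = Fin N → Carrier

    tA : Fin N → A
    tA b k = if toℕ k ≡ᵇ toℕ b then 1# else 0#

    z : ℕ → A → Carrier
    z j α' = ΣK N λ b → if toℕ b ≡ᵇ j then α' b else 0#

    -- elements of L ⊗ A written as Σ_b U_b ⊗ t^b  (U_b ∈ L)
    LA : Set a
    LA = Fin N → L

    0LA : LA
    0LA _ = 0L

    1LA : LA
    1LA b = if toℕ b ≡ᵇ 0 then 1L else 0L

    _*LA_ : LA → LA → LA
    (U *LA V) b = ΣL N λ i → ΣL N λ j →
      if (toℕ i ℕ.+ toℕ j) ≡ᵇ toℕ b then U i *L V j else 0L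

    powLA : LA → ℕ → LA
    powLA U zero    = 1LA
    powLA U (suc m) = U *LA powLA U m

    -- action of h ∈ H on L ⊗ A:  mult (1 ⊗ h) (Σ_b U_b ⊗ t^b) = Σ_b h(t^b) U_b
    act : (A → Carrier) → LA → L
    act h U = ΣL N λ b → scale (h (tA b)) (U b)

  -- The setting of Theorem 5.9.  N = p^n, r = n - 1, x^N = c, cinv = c⁻¹,
  -- inv ℓ = 1/(ℓ!(p-ℓ)!) in F_p ⊆ K.
  module Setup (p n : ℕ) (c cinv f : Carrier) (inv : ℕ → Carrier) where

    N : ℕ
    N = p ^ n

    r : ℕ
    r = n ∸ 1

    open Ext N c public

    x : L
    x = eL 1

    -- x⁻¹ = c⁻¹ x^(N-1)
    xinv : L
    xinv = scale cinv (eL (N ∸ 1))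

    xpow : ℤ → L
    xpow (+ m)     = powL x m
    xpow -[1+ m ]  = powL xinv (suc m)

    αx : LA
    αx b =
      (if toℕ b ≡ᵇ 0 then x else 0L) +L
      ((if toℕ b ≡ᵇ 1 then 1L else 0L) +L
       sumRange 0L _+L_ 1 (p ∸ 1) λ l →
         if toℕ b ≡ᵇ (p ^ r ℕ.* (p ∸ l))
         then scale (f * inv l) (powL x (p ^ r ℕ.* l))
         else 0L)

    -- α is a K-algebra homomorphism, so α(x^i) = α(x)^i
    αpow : ℕ → LA
    αpow i = powLA αx i

    zx : ℕ → ℕ → L
    zx j i = act (z j) (αpow i)

{-# OPTIONS --safe #-}
-- In L ⊗ A, α(x) = x⊗1 + 1⊗t + f Σ_ℓ x^(p^r ℓ) ⊗ t^(p^r (p-ℓ)) / (ℓ!(p-ℓ)!), and the deformation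
-- only reaches t-degree p^r through its ℓ = p-1 term g x^M ⊗ t^(p^r), where M = p^r (p-1) and
-- g = f/(p-1)!. Multiplying by α(x) therefore acts on the t^b-coefficients, b ≤ p^r, by
-- U_b ↦ x U_b + U_(b-1) (+ g x^M U_0 when b = p^r), so by induction on i the t^b-coefficient of
-- α(x)^i is C(i,b) x^(i-b) for b < p^r, and C(i,p^r) x^(i-p^r) + i g x^(M+i-1) for b = p^r.
-- The functional z_j reads off the t^j-coefficient. In characteristic p, Lucas' theorem gives
-- C(i,p^s) = i_(s), and Wilson's theorem (p-1)! = -1 (obtained from finite differences of
-- y ↦ y^(p-1) and Fermat's little theorem) gives g = -f.
module Submission where

open import Defs
open import Algebra.Bundles using (CommutativeRing)
open import Data.Nat as ℕ using (ℕ; _^_; _∸_; _≤_; _<_; _!)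
open import Data.Nat.Primality using (Prime)
open import Data.Integer as ℤ using (+_)
open import Data.Product using (_×_)
open import Relation.Nullary using (¬_)

open import Data.Bool using (Bool; true; false; if_then_else_)
open import Data.Bool.Properties using (T-≡)
open import Data.Empty using (⊥-elim)
open import Data.Fin as Fin using (Fin; toℕ; fromℕ<)
open import Data.Fin.Properties using (toℕ<n; toℕ-fromℕ<; toℕ-injective)
import Data.Integer.Properties as ℤ
open import Data.Maybe using (nothing)
open import Data.Nat using (zero; suc; _≡ᵇ_; z≤n; s≤s; NonZero)
open import Data.Nat.Combinatorics
  using (_C_; nCk+nC[k+1]≡[n+1]C[k+1]; nCk≡n!/k![n-k]!; k![n∸k]!∣n!)
open import Data.Nat.Coprimality using (coprime-Bézout; prime⇒coprime)
open import Data.Nat.DivMod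
  using (_/_; _%_; m≡m%n+[m/n]*n; m%n<n; m/n*n≡m; [m+kn]%n≡m%n; m<n⇒m%n≡m; +-distrib-/; m<n⇒m/n≡0; m*n/n≡m; m*n%n≡0)
open import Data.Nat.Divisibility using (_∣_; divides; ∣⇒≤)
import Data.Nat.GCD as GCD
open import Data.Nat.Primality using (euclidsLemma; prime⇒nonTrivial; ¬prime[0])
import Data.Nat.Properties as ℕ
import Data.Nat.Solver
open import Data.Product using (_,_; proj₁; proj₂)
open import Data.Sum using (_⊎_; inj₁; inj₂)
open import Function using (_∘_; _∘′_)
open import Function.Bundles using (Equivalence)
open import Relation.Nullary using (yes; no)
open import Relation.Binary.Bundles using (Setoid)
open import Relation.Binary.PropositionalEquality as ≡ using (_≡_; _≢_)
open import Tactic.RingSolver.Core.AlmostCommutativeRing using (AlmostCommutativeRing; fromCommutativeRing)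

module NS = Data.Nat.Solver.+-*-Solver

≡ᵇ-true : ∀ {m n} → m ≡ n → (m ≡ᵇ n) ≡ true
≡ᵇ-true {m} {n} m≡n = Equivalence.to T-≡ (ℕ.≡⇒≡ᵇ m n m≡n)

≡ᵇ-false : ∀ {m n} → m ≢ n → (m ≡ᵇ n) ≡ false
≡ᵇ-false {m} {n} m≢n with m ≡ᵇ n in eq
... | false = ≡.refl
... | true  = ⊥-elim (m≢n (ℕ.≡ᵇ⇒≡ m n (Equivalence.from T-≡ eq)))

module RingArithmetic {a ℓ} (K : CommutativeRing a ℓ) where
  open CommutativeRing K hiding (zero)
  open import Algebra.Properties.Ring ring public
    using (-‿involutive; -0#≈0#; -‿+-comm; +-inverseʳ-unique; -‿distribˡ-*; -‿distribʳ-*; -1*x≈-x; x[y-z]≈xy-xz)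
  open import Algebra.Properties.Semiring.Mult semiring using (×-homo-+; ×1-homo-*) renaming (_×_ to _×ᴷ_)
  open import Algebra.Properties.CommutativeSemiring.Exp commutativeSemiring public
    using (^-congˡ; ^-congʳ; ^-homo-*; ^-distrib-*) renaming (_^_ to _^ᴷ_)
  open import Algebra.Properties.Semiring.Sum semiring using (sum)
  open import Algebra.Properties.CommutativeSemiring.Binomial commutativeSemiring
    using () renaming (theorem to binomial)

  almostCommutativeRing : AlmostCommutativeRing a ℓ
  almostCommutativeRing = fromCommutativeRing K (λ _ → nothing)

  open import Tactic.RingSolver.NonReflective almostCommutativeRing public
    using (solve; _⊜_; _⊕_; _⊗_)
  open import Relation.Binary.Reasoning.Setoid setoid

  ⌜_⌝ : ℕ → Carrier
  ⌜_⌝ = ℕ→K K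

  ×ᴷ≈⌜⌝* : ∀ m z → m ×ᴷ z ≈ ⌜ m ⌝ * z
  ×ᴷ≈⌜⌝* zero    z = sym (zeroˡ z)
  ×ᴷ≈⌜⌝* (suc m) z = begin
    z + m ×ᴷ z           ≈⟨ +-cong (sym (*-identityˡ z)) (×ᴷ≈⌜⌝* m z) ⟩
    1# * z + ⌜ m ⌝ * z   ≈⟨ distribʳ z 1# ⌜ m ⌝ ⟨
    (1# + ⌜ m ⌝) * z     ∎

  ⌜⌝≡×ᴷ1# : ∀ m → ⌜ m ⌝ ≡ m ×ᴷ 1#
  ⌜⌝≡×ᴷ1# zero    = ≡.refl
  ⌜⌝≡×ᴷ1# (suc m) = ≡.cong (λ z → 1# + z) (⌜⌝≡×ᴷ1# m)

  ⌜⌝-+ : ∀ m n → ⌜ m ℕ.+ n ⌝ ≈ ⌜ m ⌝ + ⌜ n ⌝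
  ⌜⌝-+ m n rewrite ⌜⌝≡×ᴷ1# (m ℕ.+ n) | ⌜⌝≡×ᴷ1# m | ⌜⌝≡×ᴷ1# n = ×-homo-+ 1# m n

  ⌜⌝-* : ∀ m n → ⌜ m ℕ.* n ⌝ ≈ ⌜ m ⌝ * ⌜ n ⌝
  ⌜⌝-* m n rewrite ⌜⌝≡×ᴷ1# (m ℕ.* n) | ⌜⌝≡×ᴷ1# m | ⌜⌝≡×ᴷ1# n = ×1-homo-* m n

  1#^ : ∀ k → 1# ^ᴷ k ≈ 1#
  1#^ zero    = refl
  1#^ (suc k) = trans (*-identityˡ _) (1#^ k)

  [-1]^k*[-1]^k≈1 : ∀ k → (- 1#) ^ᴷ k * (- 1#) ^ᴷ k ≈ 1#
  [-1]^k*[-1]^k≈1 k = begin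
    (- 1#) ^ᴷ k * (- 1#) ^ᴷ k  ≈⟨ ^-distrib-* (- 1#) (- 1#) k ⟨
    (- 1# * - 1#) ^ᴷ k         ≈⟨ ^-congˡ k (trans (-1*x≈-x (- 1#)) (-‿involutive 1#)) ⟩
    1# ^ᴷ k                    ≈⟨ 1#^ k ⟩
    1#                         ∎

  ∑ℕ : ℕ → (ℕ → Carrier) → Carrier
  ∑ℕ zero    f = 0#
  ∑ℕ (suc n) f = f 0 + ∑ℕ n (f ∘ suc)

  sum≈∑ℕ : ∀ n f → sum {n} (f ∘ toℕ) ≈ ∑ℕ n f
  sum≈∑ℕ zero    f = refl
  sum≈∑ℕ (suc n) f = +-congˡ (sum≈∑ℕ n (f ∘ suc))

  ∑ℕ-cong : ∀ n {f g} → (∀ k → k < n → f k ≈ g k) → ∑ℕ n f ≈ ∑ℕ n g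
  ∑ℕ-cong zero    f≈g = refl
  ∑ℕ-cong (suc n) f≈g = +-cong (f≈g 0 (s≤s z≤n)) (∑ℕ-cong n (λ k k<n → f≈g (suc k) (s≤s k<n)))

  ∑ℕ-zero : ∀ n {f} → (∀ k → k < n → f k ≈ 0#) → ∑ℕ n f ≈ 0#
  ∑ℕ-zero zero    f≈0 = refl
  ∑ℕ-zero (suc n) f≈0 =
    trans (+-cong (f≈0 0 (s≤s z≤n)) (∑ℕ-zero n (λ k k<n → f≈0 (suc k) (s≤s k<n)))) (+-identityʳ 0#)

  ∑ℕ-last : ∀ n f → ∑ℕ (suc n) f ≈ ∑ℕ n f + f n
  ∑ℕ-last zero    f = trans (+-identityʳ (f 0)) (sym (+-identityˡ (f 0)))
  ∑ℕ-last (suc n) f = trans (+-congˡ (∑ℕ-last n (f ∘ suc))) (sym (+-assoc _ _ _))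

  ∑ℕ-+ : ∀ n f g → ∑ℕ n (λ k → f k + g k) ≈ ∑ℕ n f + ∑ℕ n g
  ∑ℕ-+ zero    f g = sym (+-identityʳ 0#)
  ∑ℕ-+ (suc n) f g = trans (+-congˡ (∑ℕ-+ n (f ∘ suc) (g ∘ suc)))
    (solve 4 (λ a b c d → ((a ⊕ b) ⊕ (c ⊕ d)) ⊜ ((a ⊕ c) ⊕ (b ⊕ d))) refl (f 0) (g 0) _ _)

  *-distribˡ-∑ℕ : ∀ n x f → x * ∑ℕ n f ≈ ∑ℕ n (λ k → x * f k)
  *-distribˡ-∑ℕ zero    x f = zeroʳ x
  *-distribˡ-∑ℕ (suc n) x f = trans (distribˡ x (f 0) _) (+-congˡ (*-distribˡ-∑ℕ n x (f ∘ suc)))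

  -‿∑ℕ : ∀ n f → - ∑ℕ n f ≈ ∑ℕ n (λ k → - f k)
  -‿∑ℕ n f = begin
    - ∑ℕ n f                  ≈⟨ -1*x≈-x _ ⟨
    - 1# * ∑ℕ n f             ≈⟨ *-distribˡ-∑ℕ n (- 1#) f ⟩
    ∑ℕ n (λ k → - 1# * f k)   ≈⟨ ∑ℕ-cong n (λ k _ → -1*x≈-x (f k)) ⟩
    ∑ℕ n (λ k → - f k)        ∎

  binom : ℕ → ℕ → Carrier
  binom n       zero    = 1#
  binom zero    (suc k) = 0#
  binom (suc n) (suc k) = binom n k + binom n (suc k)

  binom-≡ : ∀ {m n k l} → m ≡ n → k ≡ l → binom m k ≈ binom n l
  binom-≡ ≡.refl ≡.refl = refl

  binom-≡ˡ : ∀ {m n} k → m ≡ n → binom m k ≈ binom n k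
  binom-≡ˡ k ≡.refl = refl

  binom-≡ʳ : ∀ m {k l} → k ≡ l → binom m k ≈ binom m l
  binom-≡ʳ m ≡.refl = refl

  binom-> : ∀ {n k} → n < k → binom n k ≈ 0#
  binom-> {zero}  {suc k} _           = refl
  binom-> {suc n} {suc k} (s≤s n<k) =
    trans (+-cong (binom-> n<k) (binom-> (ℕ.m<n⇒m<1+n n<k))) (+-identityʳ 0#)

  binom-diag : ∀ n → binom n n ≈ 1#
  binom-diag zero    = refl
  binom-diag (suc n) = trans (+-cong (binom-diag n) (binom-> (ℕ.n<1+n n))) (+-identityʳ 1#)

  binom-1 : ∀ n → binom n 1 ≈ ⌜ n ⌝
  binom-1 zero    = refl
  binom-1 (suc n) = +-congˡ (binom-1 n)

  binom-subdiag : ∀ m → binom (suc m) m ≈ ⌜ suc m ⌝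
  binom-subdiag zero    = sym (+-identityʳ 1#)
  binom-subdiag (suc m) = trans (+-cong (binom-subdiag m) (binom-diag (suc m))) (+-comm _ 1#)

  binom≈⌜C⌝ : ∀ n k → binom n k ≈ ⌜ n C k ⌝
  binom≈⌜C⌝ n       zero    = sym (+-identityʳ 1#)
  binom≈⌜C⌝ zero    (suc k) = refl
  binom≈⌜C⌝ (suc n) (suc k) = begin
    binom n k + binom n (suc k)     ≈⟨ +-cong (binom≈⌜C⌝ n k) (binom≈⌜C⌝ n (suc k)) ⟩
    ⌜ n C k ⌝ + ⌜ n C suc k ⌝       ≈⟨ ⌜⌝-+ (n C k) (n C suc k) ⟨
    ⌜ n C k ℕ.+ n C suc k ⌝         ≡⟨ ≡.cong ⌜_⌝ (nCk+nC[k+1]≡[n+1]C[k+1] n k) ⟩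
    ⌜ suc n C suc k ⌝               ∎

  binomial-theorem : ∀ n y → (y + 1#) ^ᴷ n ≈ ∑ℕ (suc n) (λ k → binom n k * y ^ᴷ k)
  binomial-theorem n y = begin
    (y + 1#) ^ᴷ n                                              ≈⟨ binomial n y 1# ⟩
    sum {suc n} (expansionTerm ∘ toℕ)                           ≈⟨ sum≈∑ℕ (suc n) expansionTerm ⟩
    ∑ℕ (suc n) expansionTerm                                   ≈⟨ ∑ℕ-cong (suc n) term ⟩
    ∑ℕ (suc n) (λ k → binom n k * y ^ᴷ k)                      ∎
    where
    expansionTerm : ℕ → Carrier
    expansionTerm k = (n C k) ×ᴷ (y ^ᴷ k * 1# ^ᴷ (n ∸ k))
    term : ∀ k → k < suc n → expansionTerm k ≈ binom n k * y ^ᴷ k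
    term k _ = begin
      (n C k) ×ᴷ (y ^ᴷ k * 1# ^ᴷ (n ∸ k))   ≈⟨ ×ᴷ≈⌜⌝* (n C k) _ ⟩
      ⌜ n C k ⌝ * (y ^ᴷ k * 1# ^ᴷ (n ∸ k))
        ≈⟨ *-cong (sym (binom≈⌜C⌝ n k)) (trans (*-congˡ (1#^ (n ∸ k))) (*-identityʳ _)) ⟩
      binom n k * y ^ᴷ k                    ∎

  ∑ℕ-pascal : ∀ n (F : ℕ → Carrier) → ∑ℕ (suc (suc n)) (λ k → binom (suc n) k * F k)
                     ≈ ∑ℕ (suc n) (λ k → binom n k * F k) + ∑ℕ (suc n) (λ k → binom n k * F (suc k))
  ∑ℕ-pascal n F = begin
    1# * F 0 + ∑ℕ (suc n) (λ k → binom (suc n) (suc k) * F (suc k))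
      ≈⟨ +-congˡ (∑ℕ-cong (suc n) {λ k → binom (suc n) (suc k) * F (suc k)}
                     (λ k _ → distribʳ (F (suc k)) (binom n k) (binom n (suc k)))) ⟩
    1# * F 0 + ∑ℕ (suc n) (λ k → binom n k * F (suc k) + binom n (suc k) * F (suc k))
      ≈⟨ +-congˡ (∑ℕ-+ (suc n) (λ k → binom n k * F (suc k)) (λ k → binom n (suc k) * F (suc k))) ⟩
    1# * F 0 + (S′ + ∑ℕ (suc n) (λ k → binom n (suc k) * F (suc k)))
      ≈⟨ +-congˡ (+-congˡ (∑ℕ-last n (λ k → binom n (suc k) * F (suc k)))) ⟩
    1# * F 0 + (S′ + (T + binom n (suc n) * F (suc n)))
      ≈⟨ +-congˡ (+-congˡ (trans (+-congˡ (trans (*-congʳ (binom-> (ℕ.n<1+n n))) (zeroˡ _))) (+-identityʳ T))) ⟩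
    1# * F 0 + (S′ + T)
      ≈⟨ solve 3 (λ a s t → (a ⊕ (s ⊕ t)) ⊜ ((a ⊕ t) ⊕ s)) refl (1# * F 0) S′ T ⟩
    (1# * F 0 + T) + S′ ∎
    where
    S′ = ∑ℕ (suc n) (λ k → binom n k * F (suc k))
    T  = ∑ℕ n (λ k → binom n (suc k) * F (suc k))

  Δ : (ℕ → Carrier) → ℕ → Carrier
  Δ g y = g y - g (suc y)

  Δ^ : ℕ → (ℕ → Carrier) → ℕ → Carrier
  Δ^ zero    g = g
  Δ^ (suc m) g = Δ (Δ^ m g)

  Δ^-cong : ∀ m {g h} → (∀ y → g y ≈ h y) → ∀ y → Δ^ m g y ≈ Δ^ m h y
  Δ^-cong zero    g≈h y = g≈h y
  Δ^-cong (suc m) g≈h y = +-cong (Δ^-cong m g≈h y) (-‿cong (Δ^-cong m g≈h (suc y)))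

  Δ^-suc : ∀ m g y → Δ^ (suc m) g y ≈ Δ^ m (Δ g) y
  Δ^-suc zero    g y = refl
  Δ^-suc (suc m) g y = +-cong (Δ^-suc m g y) (-‿cong (Δ^-suc m g (suc y)))

  ∑ℕ-- : ∀ n f g → ∑ℕ n f - ∑ℕ n g ≈ ∑ℕ n (λ k → f k - g k)
  ∑ℕ-- n f g = trans (+-congˡ (-‿∑ℕ n g)) (sym (∑ℕ-+ n f (λ k → - g k)))

  Δ^-linear : ∀ m n (c : ℕ → Carrier) (h : ℕ → ℕ → Carrier) y →
              Δ^ m (λ y → ∑ℕ n (λ k → c k * h k y)) y ≈ ∑ℕ n (λ k → c k * Δ^ m (h k) y)
  Δ^-linear zero    n c h y = refl
  Δ^-linear (suc m) n c h y = begin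
    Δ^ m S y - Δ^ m S (suc y)
      ≈⟨ +-cong (Δ^-linear m n c h y) (-‿cong (Δ^-linear m n c h (suc y))) ⟩
    ∑ℕ n (λ k → c k * Δ^ m (h k) y) - ∑ℕ n (λ k → c k * Δ^ m (h k) (suc y))
      ≈⟨ ∑ℕ-- n _ _ ⟩
    ∑ℕ n (λ k → c k * Δ^ m (h k) y - c k * Δ^ m (h k) (suc y))
      ≈⟨ ∑ℕ-cong n (λ k _ → sym (x[y-z]≈xy-xz (c k) _ _)) ⟩
    ∑ℕ n (λ k → c k * Δ^ (suc m) (h k) y) ∎
    where
    S = λ y → ∑ℕ n (λ k → c k * h k y)

  Δ^-expansion : ∀ m g y → Δ^ m g y ≈ ∑ℕ (suc m) (λ k → binom m k * ((- 1#) ^ᴷ k * g (k ℕ.+ y)))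
  Δ^-expansion zero    g y = sym (trans (+-identityʳ _) (trans (*-identityˡ _) (*-identityˡ _)))
  Δ^-expansion (suc m) g y = begin
    Δ^ m g y - Δ^ m g (suc y)
      ≈⟨ +-cong (Δ^-expansion m g y) (-‿cong (Δ^-expansion m g (suc y))) ⟩
    ∑ℕ (suc m) (λ k → binom m k * F k) - ∑ℕ (suc m) F′
      ≈⟨ +-congˡ (trans (-‿∑ℕ (suc m) F′) (∑ℕ-cong (suc m) {λ k → - F′ k} (λ k _ → shift k))) ⟩
    ∑ℕ (suc m) (λ k → binom m k * F k) + ∑ℕ (suc m) (λ k → binom m k * F (suc k))
      ≈⟨ ∑ℕ-pascal m F ⟨
    ∑ℕ (suc (suc m)) (λ k → binom (suc m) k * F k) ∎
    where
    F : ℕ → Carrier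
    F k = (- 1#) ^ᴷ k * g (k ℕ.+ y)
    F′ : ℕ → Carrier
    F′ k = binom m k * ((- 1#) ^ᴷ k * g (k ℕ.+ suc y))
    shift : ∀ k → - F′ k ≈ binom m k * F (suc k)
    shift k = trans (-‿cong (*-congˡ (*-congˡ (reflexive (≡.cong g (ℕ.+-suc k y))))))
      (trans (-‿distribʳ-* (binom m k) _)
        (*-congˡ (trans (-‿distribˡ-* ((- 1#) ^ᴷ k) _) (*-congʳ (sym (-1*x≈-x _))))))

  ∑ℕ-1# : ∀ n → ∑ℕ n (λ _ → 1#) ≈ ⌜ n ⌝
  ∑ℕ-1# zero    = refl
  ∑ℕ-1# (suc n) = +-congˡ (∑ℕ-1# n)

  monomial : ℕ → ℕ → Carrier
  monomial j y = ⌜ y ⌝ ^ᴷ j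

  Δ-monomial : ∀ m y → Δ (monomial (suc m)) y ≈ - ∑ℕ (suc m) (λ k → binom (suc m) k * monomial k y)
  Δ-monomial m y = begin
    A - (1# + ⌜ y ⌝) ^ᴷ suc m
      ≈⟨ +-congˡ (-‿cong (trans (^-congˡ (suc m) (+-comm 1# ⌜ y ⌝)) (binomial-theorem (suc m) ⌜ y ⌝))) ⟩
    A - ∑ℕ (suc (suc m)) (λ k → binom (suc m) k * monomial k y)
      ≈⟨ +-congˡ (-‿cong (∑ℕ-last (suc m) (λ k → binom (suc m) k * monomial k y))) ⟩
    A - (T + binom (suc m) (suc m) * A)
      ≈⟨ +-congˡ (-‿cong (+-congˡ (trans (*-congʳ (binom-diag (suc m))) (*-identityˡ A)))) ⟩
    A - (T + A)
      ≈⟨ +-congˡ (-‿+-comm T A) ⟨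
    A + (- T + - A)
      ≈⟨ solve 3 (λ a t b → (a ⊕ (t ⊕ b)) ⊜ (t ⊕ (a ⊕ b))) refl A (- T) (- A) ⟩
    - T + (A - A)
      ≈⟨ trans (+-congˡ (-‿inverseʳ A)) (+-identityʳ (- T)) ⟩
    - T ∎
    where
    A = monomial (suc m) y
    T = ∑ℕ (suc m) (λ k → binom (suc m) k * monomial k y)

  Δ^-monomial-top : ∀ m → (∀ k → k < m → ∀ y → Δ^ m (monomial k) y ≈ 0#) →
                    (∀ y → Δ^ m (monomial m) y ≈ (- 1#) ^ᴷ m * ⌜ m ! ⌝) →
                    ∀ y → Δ^ (suc m) (monomial (suc m)) y ≈ (- 1#) ^ᴷ suc m * ⌜ suc m ! ⌝
  Δ^-monomial-top m lower top y = begin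
    Δ^ (suc m) (monomial (suc m)) y
      ≈⟨ Δ^-suc m (monomial (suc m)) y ⟩
    Δ^ m (Δ (monomial (suc m))) y
      ≈⟨ Δ^-cong m (λ y → trans (Δ-monomial m y) (-‿∑ℕ (suc m) (λ k → binom (suc m) k * monomial k y))) y ⟩
    Δ^ m (λ y → ∑ℕ (suc m) (λ k → - (binom (suc m) k * monomial k y))) y
      ≈⟨ Δ^-cong m (λ y → ∑ℕ-cong (suc m) {λ k → - (binom (suc m) k * monomial k y)}
                            (λ k _ → -‿distribˡ-* _ _)) y ⟩
    Δ^ m (λ y → ∑ℕ (suc m) (λ k → - binom (suc m) k * monomial k y)) y
      ≈⟨ Δ^-linear m (suc m) (λ k → - binom (suc m) k) monomial y ⟩
    ∑ℕ (suc m) (λ k → - binom (suc m) k * Δ^ m (monomial k) y)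
      ≈⟨ ∑ℕ-last m (λ k → - binom (suc m) k * Δ^ m (monomial k) y) ⟩
    ∑ℕ m (λ k → - binom (suc m) k * Δ^ m (monomial k) y) + - binom (suc m) m * Δ^ m (monomial m) y
      ≈⟨ +-cong (∑ℕ-zero m (λ k k<m → trans (*-congˡ (lower k k<m y)) (zeroʳ _)))
                (*-cong (-‿cong (binom-subdiag m)) (top y)) ⟩
    0# + - ⌜ suc m ⌝ * ((- 1#) ^ᴷ m * ⌜ m ! ⌝)
      ≈⟨ trans (+-identityˡ _) (*-congʳ (sym (-1*x≈-x _))) ⟩
    (- 1# * ⌜ suc m ⌝) * ((- 1#) ^ᴷ m * ⌜ m ! ⌝)
      ≈⟨ solve 4 (λ u n s f → ((u ⊗ n) ⊗ (s ⊗ f)) ⊜ ((u ⊗ s) ⊗ (n ⊗ f)))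
                 refl (- 1#) ⌜ suc m ⌝ ((- 1#) ^ᴷ m) ⌜ m ! ⌝ ⟩
    (- 1#) ^ᴷ suc m * (⌜ suc m ⌝ * ⌜ m ! ⌝)
      ≈⟨ *-congˡ (⌜⌝-* (suc m) (m !)) ⟨
    (- 1#) ^ᴷ suc m * ⌜ suc m ! ⌝ ∎

  Δ^-monomial : ∀ m → (∀ y → Δ^ m (monomial m) y ≈ (- 1#) ^ᴷ m * ⌜ m ! ⌝)
                    × (∀ j → j < m → ∀ y → Δ^ m (monomial j) y ≈ 0#)
  Δ^-monomial zero    = (λ y → sym (trans (*-identityˡ _) (+-identityʳ 1#))) , (λ _ ())
  Δ^-monomial (suc m) = Δ^-monomial-top m lower top , lower′
    where
    top   = proj₁ (Δ^-monomial m)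
    lower = proj₂ (Δ^-monomial m)
    lower′ : ∀ j → j < suc m → ∀ y → Δ^ (suc m) (monomial j) y ≈ 0#
    lower′ j j<1+m y with ℕ.m≤n⇒m<n∨m≡n (ℕ.≤-pred j<1+m)
    ... | inj₁ j<m     = trans (+-cong (lower j j<m y) (-‿cong (lower j j<m (suc y))))
                               (trans (+-congˡ -0#≈0#) (+-identityʳ 0#))
    ... | inj₂ ≡.refl = trans (+-cong (top y) (-‿cong (top (suc y)))) (-‿inverseʳ _)

module CharacteristicP {a ℓ} (K : CommutativeRing a ℓ) (q : ℕ) (p-prime : Prime (suc q))
                       (char-p : CommutativeRing._≈_ K (ℕ→K K (suc q)) (CommutativeRing.0# K)) where
  open CommutativeRing K hiding (zero)
  open RingArithmetic K
  open import Relation.Binary.Reasoning.Setoid setoid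

  p : ℕ
  p = suc q

  1≤q : 1 ≤ q
  1≤q = ℕ.≤-pred (ℕ.nonTrivial⇒n>1 p {{prime⇒nonTrivial p-prime}})

  p*0 : p ℕ.* 0 ≡ 0
  p*0 = ℕ.*-zeroʳ p

  ⌜⌝-multiple : ∀ {n} → ⌜ n ⌝ ≈ 0# → ∀ m → ⌜ m ℕ.* n ⌝ ≈ 0#
  ⌜⌝-multiple {n} n≈0 m = trans (⌜⌝-* m n) (trans (*-congˡ n≈0) (zeroʳ _))

  ⌜⌝-p∣ : ∀ {m} → p ∣ m → ⌜ m ⌝ ≈ 0#
  ⌜⌝-p∣ (divides t ≡.refl) = ⌜⌝-multiple char-p t

  ⌜⌝-mod : ∀ m → ⌜ m ⌝ ≈ ⌜ m % p ⌝
  ⌜⌝-mod m = begin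
    ⌜ m ⌝                          ≡⟨ ≡.cong ⌜_⌝ (m≡m%n+[m/n]*n m p) ⟩
    ⌜ m % p ℕ.+ m / p ℕ.* p ⌝      ≈⟨ ⌜⌝-+ (m % p) (m / p ℕ.* p) ⟩
    ⌜ m % p ⌝ + ⌜ m / p ℕ.* p ⌝    ≈⟨ +-congˡ (⌜⌝-multiple char-p (m / p)) ⟩
    ⌜ m % p ⌝ + 0#                 ≈⟨ +-identityʳ _ ⟩
    ⌜ m % p ⌝                      ∎

  p∣m!⇒p≤m : ∀ m → p ∣ m ! → p ≤ m
  p∣m!⇒p≤m zero    p∣1 = ⊥-elim (ℕ.<⇒≱ (s≤s 1≤q) (∣⇒≤ p∣1))
  p∣m!⇒p≤m (suc m) p∣m! with euclidsLemma (suc m) (m !) p-prime p∣m!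
  ... | inj₁ p∣1+m = ∣⇒≤ p∣1+m
  ... | inj₂ p∣m!′ = ℕ.m≤n⇒m≤1+n (p∣m!⇒p≤m m p∣m!′)

  p∣pCk : ∀ k → 1 ≤ k → k < p → p ∣ p C k
  p∣pCk k 1≤k k<p with euclidsLemma (p C k) (k ! ℕ.* (p ∸ k) !) p-prime p∣product
    where
    k≤p = ℕ.<⇒≤ k<p
    instance _ = k ℕ.!* (p ∸ k) !≢0
    p∣product : p ∣ (p C k) ℕ.* (k ! ℕ.* (p ∸ k) !)
    p∣product = ≡.subst (p ∣_)
      (≡.sym (≡.trans (≡.cong (ℕ._* (k ! ℕ.* (p ∸ k) !)) (nCk≡n!/k![n-k]! k≤p)) (m/n*n≡m (k![n∸k]!∣n! k≤p))))
      (divides (q !) (ℕ.*-comm p (q !)))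
  ... | inj₁ p∣pCk = p∣pCk
  ... | inj₂ p∣k![p-k]! with euclidsLemma (k !) ((p ∸ k) !) p-prime p∣k![p-k]!
  ... | inj₁ p∣k!     = ⊥-elim (ℕ.<⇒≱ k<p (p∣m!⇒p≤m k p∣k!))
  ... | inj₂ p∣[p-k]! = ⊥-elim (ℕ.<⇒≱ (p-k<p k 1≤k) (p∣m!⇒p≤m (p ∸ k) p∣[p-k]!))
    where
    p-k<p : ∀ k → 1 ≤ k → p ∸ k < p
    p-k<p (suc k) _ = s≤s (ℕ.m∸n≤m q k)

  binom-p : ∀ k → 1 ≤ k → k < p → binom p k ≈ 0#
  binom-p k 1≤k k<p = trans (binom≈⌜C⌝ p k) (⌜⌝-p∣ (p∣pCk k 1≤k k<p))

  binom-[p-1] : ∀ k → k ≤ q → binom q k ≈ (- 1#) ^ᴷ k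
  binom-[p-1] zero    _   = refl
  binom-[p-1] (suc k) k<q = begin
    binom q (suc k)         ≈⟨ +-inverseʳ-unique _ _ (binom-p (suc k) (s≤s z≤n) (s≤s k<q)) ⟩
    - binom q k             ≈⟨ -‿cong (binom-[p-1] k (ℕ.<⇒≤ k<q)) ⟩
    - (- 1#) ^ᴷ k           ≈⟨ -1*x≈-x _ ⟨
    (- 1#) ^ᴷ suc k         ∎

  frobenius-+1 : ∀ y → (y + 1#) ^ᴷ p ≈ y ^ᴷ p + 1#
  frobenius-+1 y = begin
    (y + 1#) ^ᴷ p
      ≈⟨ binomial-theorem p y ⟩
    1# * 1# + ∑ℕ p (λ k → binom p (suc k) * y ^ᴷ suc k)
      ≈⟨ +-cong (*-identityˡ 1#) (∑ℕ-last q (λ k → binom p (suc k) * y ^ᴷ suc k)) ⟩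
    1# + (∑ℕ q (λ k → binom p (suc k) * y ^ᴷ suc k) + binom p p * y ^ᴷ p)
      ≈⟨ +-congˡ (+-cong (∑ℕ-zero q (λ k k<q → trans (*-congʳ (binom-p (suc k) (s≤s z≤n) (s≤s k<q))) (zeroˡ _)))
                         (trans (*-congʳ (binom-diag p)) (*-identityˡ _))) ⟩
    1# + (0# + y ^ᴷ p)
      ≈⟨ trans (+-congˡ (+-identityˡ _)) (+-comm 1# _) ⟩
    y ^ᴷ p + 1#         ∎

  fermat : ∀ k → ⌜ k ⌝ ^ᴷ p ≈ ⌜ k ⌝
  fermat zero    = zeroˡ _
  fermat (suc k) = begin
    (1# + ⌜ k ⌝) ^ᴷ p   ≈⟨ ^-congˡ p (+-comm 1# ⌜ k ⌝) ⟩
    (⌜ k ⌝ + 1#) ^ᴷ p   ≈⟨ frobenius-+1 ⌜ k ⌝ ⟩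
    ⌜ k ⌝ ^ᴷ p + 1#     ≈⟨ +-congʳ (fermat k) ⟩
    ⌜ k ⌝ + 1#          ≈⟨ +-comm ⌜ k ⌝ 1# ⟩
    1# + ⌜ k ⌝          ∎

  module _ (1≉0 : ¬ 1# ≈ 0#) where

    ⌜⌝≉0 : ∀ k → 1 ≤ k → k < p → ¬ ⌜ k ⌝ ≈ 0#
    ⌜⌝≉0 k@(suc _) _ k<p k≈0 with coprime-Bézout (prime⇒coprime p-prime k<p)
    ... | GCD.Bézout.+- x y eq = 1≉0 (begin
      1#                     ≈⟨ +-identityʳ 1# ⟨
      1# + 0#                ≈⟨ +-congˡ (⌜⌝-multiple k≈0 y) ⟨
      ⌜ 1 ℕ.+ y ℕ.* k ⌝      ≡⟨ ≡.cong ⌜_⌝ eq ⟩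
      ⌜ x ℕ.* p ⌝            ≈⟨ ⌜⌝-multiple char-p x ⟩
      0#                     ∎)
    ... | GCD.Bézout.-+ x y eq = 1≉0 (begin
      1#                     ≈⟨ +-identityʳ 1# ⟨
      1# + 0#                ≈⟨ +-congˡ (⌜⌝-multiple char-p x) ⟨
      ⌜ 1 ℕ.+ x ℕ.* p ⌝      ≡⟨ ≡.cong ⌜_⌝ eq ⟩
      ⌜ y ℕ.* k ⌝            ≈⟨ ⌜⌝-multiple k≈0 y ⟩
      0#                     ∎)

  module _ (field-K : IsField K) where

    fermat-unit : ∀ k → 1 ≤ k → k < p → ⌜ k ⌝ ^ᴷ q ≈ 1#
    fermat-unit k 1≤k k<p with proj₂ field-K ⌜ k ⌝ (⌜⌝≉0 (proj₁ field-K) k 1≤k k<p)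
    ... | v , kv≈1 = begin
      ⌜ k ⌝ ^ᴷ q                  ≈⟨ *-identityʳ _ ⟨
      ⌜ k ⌝ ^ᴷ q * 1#             ≈⟨ *-congˡ kv≈1 ⟨
      ⌜ k ⌝ ^ᴷ q * (⌜ k ⌝ * v)    ≈⟨ *-assoc _ _ _ ⟨
      (⌜ k ⌝ ^ᴷ q * ⌜ k ⌝) * v    ≈⟨ *-congʳ (*-comm _ _) ⟩
      ⌜ k ⌝ ^ᴷ p * v              ≈⟨ *-congʳ (fermat k) ⟩
      ⌜ k ⌝ * v                   ≈⟨ kv≈1 ⟩
      1#                          ∎

    ⌜q⌝≈-1 : ⌜ q ⌝ ≈ - 1#
    ⌜q⌝≈-1 = +-inverseʳ-unique 1# ⌜ q ⌝ char-p

    -- Δ^(p-1) of y ↦ y^(p-1) at 0 is (-1)^(p-1) (p-1)!, and by its expansion and Fermat's little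
    -- theorem also 1 + ⋯ + 1 = p - 1.
    wilson : ⌜ q ! ⌝ ≈ - 1#
    wilson = begin
      ⌜ q ! ⌝                                   ≈⟨ *-identityˡ _ ⟨
      1# * ⌜ q ! ⌝                              ≈⟨ *-congʳ [-1]^q≈1 ⟨
      (- 1#) ^ᴷ q * ⌜ q ! ⌝                     ≈⟨ proj₁ (Δ^-monomial q) 0 ⟨
      Δ^ q (monomial q) 0                       ≈⟨ Δ^-expansion q (monomial q) 0 ⟩
      ∑ℕ p (λ k → binom q k * ((- 1#) ^ᴷ k * monomial q (k ℕ.+ 0)))
        ≈⟨ ∑ℕ-cong p (λ k k<p → signs-cancel k (ℕ.≤-pred k<p)) ⟩
      monomial q 0 + ∑ℕ q (λ k → monomial q (suc k))
        ≈⟨ +-cong (monomial-at-0 q 1≤q) (∑ℕ-cong q (λ k k<q → fermat-unit (suc k) (s≤s z≤n) (s≤s k<q))) ⟩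
      0# + ∑ℕ q (λ _ → 1#)                      ≈⟨ trans (+-identityˡ _) (∑ℕ-1# q) ⟩
      ⌜ q ⌝                                     ≈⟨ ⌜q⌝≈-1 ⟩
      - 1#                                      ∎
      where
      [-1]^q≈1 : (- 1#) ^ᴷ q ≈ 1#
      [-1]^q≈1 = trans (^-congˡ q (sym ⌜q⌝≈-1)) (fermat-unit q 1≤q (ℕ.n<1+n q))
      monomial-at-0 : ∀ n → 1 ≤ n → monomial n 0 ≈ 0#
      monomial-at-0 (suc n) _ = zeroˡ _
      signs-cancel : ∀ k → k ≤ q → binom q k * ((- 1#) ^ᴷ k * monomial q (k ℕ.+ 0)) ≈ monomial q k
      signs-cancel k k≤q = begin
        binom q k * ((- 1#) ^ᴷ k * monomial q (k ℕ.+ 0))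
          ≈⟨ *-cong (binom-[p-1] k k≤q) (*-congˡ (reflexive (≡.cong (monomial q) (ℕ.+-identityʳ k)))) ⟩
        (- 1#) ^ᴷ k * ((- 1#) ^ᴷ k * monomial q k)   ≈⟨ *-assoc _ _ _ ⟨
        ((- 1#) ^ᴷ k * (- 1#) ^ᴷ k) * monomial q k   ≈⟨ *-congʳ ([-1]^k*[-1]^k≈1 k) ⟩
        1# * monomial q k                           ≈⟨ *-identityˡ _ ⟩
        monomial q k                                ∎

  lucas : ∀ I a → a < p → ∀ J b → b < p → binom (a ℕ.+ p ℕ.* I) (b ℕ.+ p ℕ.* J) ≈ binom a b * binom I J
  lucas zero zero _ zero zero _ = trans (binom-≡ p*0 p*0) (sym (*-identityˡ 1#))
  lucas zero zero _ J (suc b) _ =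
    trans (binom-≡ˡ (suc b ℕ.+ p ℕ.* J) p*0) (sym (zeroˡ _))
  lucas zero zero _ (suc J) zero _ =
    trans (binom-≡ p*0 (ℕ.*-suc p J)) (sym (zeroʳ _))
  lucas I (suc a) 1+a<p J (suc b) 1+b<p = begin
    binom (a ℕ.+ p ℕ.* I) (b ℕ.+ p ℕ.* J) + binom (a ℕ.+ p ℕ.* I) (suc b ℕ.+ p ℕ.* J)
      ≈⟨ +-cong (lucas I a a<p J b (ℕ.<-trans (ℕ.n<1+n b) 1+b<p)) (lucas I a a<p J (suc b) 1+b<p) ⟩
    binom a b * binom I J + binom a (suc b) * binom I J
      ≈⟨ distribʳ _ _ _ ⟨
    binom (suc a) (suc b) * binom I J ∎
    where a<p = ℕ.<-trans (ℕ.n<1+n a) 1+a<p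
  lucas I (suc a) _ zero zero _ = trans (binom-≡ʳ (suc a ℕ.+ p ℕ.* I) p*0) (sym (*-identityˡ 1#))
  lucas I (suc a) 1+a<p (suc J) zero _ = begin
    binom (suc a ℕ.+ p ℕ.* I) (p ℕ.* suc J)
      ≈⟨ binom-≡ʳ (suc a ℕ.+ p ℕ.* I) (ℕ.*-suc p J) ⟩
    binom (a ℕ.+ p ℕ.* I) (q ℕ.+ p ℕ.* J) + binom (a ℕ.+ p ℕ.* I) (p ℕ.+ p ℕ.* J)
      ≈⟨ +-cong (lucas I a a<p J q (ℕ.n<1+n q))
                (trans (binom-≡ʳ (a ℕ.+ p ℕ.* I) (≡.sym (ℕ.*-suc p J))) (lucas I a a<p (suc J) 0 (s≤s z≤n))) ⟩
    binom a q * binom I J + 1# * binom I (suc J)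
      ≈⟨ +-congʳ (trans (*-congʳ (binom-> (ℕ.≤-pred 1+a<p))) (zeroˡ _)) ⟩
    0# + 1# * binom I (suc J)
      ≈⟨ +-identityˡ _ ⟩
    1# * binom I (suc J) ∎
    where a<p = ℕ.<-trans (ℕ.n<1+n a) 1+a<p
  lucas (suc I) zero _ J (suc b) 1+b<p = begin
    binom (p ℕ.* suc I) (suc b ℕ.+ p ℕ.* J)
      ≈⟨ binom-≡ˡ (suc b ℕ.+ p ℕ.* J) (ℕ.*-suc p I) ⟩
    binom (q ℕ.+ p ℕ.* I) (b ℕ.+ p ℕ.* J) + binom (q ℕ.+ p ℕ.* I) (suc b ℕ.+ p ℕ.* J)
      ≈⟨ +-cong (lucas I q (ℕ.n<1+n q) J b (ℕ.<-trans (ℕ.n<1+n b) 1+b<p)) (lucas I q (ℕ.n<1+n q) J (suc b) 1+b<p) ⟩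
    binom q b * binom I J + binom q (suc b) * binom I J
      ≈⟨ distribʳ _ _ _ ⟨
    binom p (suc b) * binom I J
      ≈⟨ trans (*-congʳ (binom-p (suc b) (s≤s z≤n) 1+b<p)) (zeroˡ _) ⟩
    0#
      ≈⟨ zeroˡ _ ⟨
    binom 0 (suc b) * binom (suc I) J ∎
  lucas (suc I) zero _ zero zero _ = trans (binom-≡ʳ (p ℕ.* suc I) p*0) (sym (*-identityˡ 1#))
  lucas (suc I) zero _ (suc J) zero _ = begin
    binom (p ℕ.* suc I) (p ℕ.* suc J)
      ≈⟨ binom-≡ (ℕ.*-suc p I) (ℕ.*-suc p J) ⟩
    binom (q ℕ.+ p ℕ.* I) (q ℕ.+ p ℕ.* J) + binom (q ℕ.+ p ℕ.* I) (p ℕ.+ p ℕ.* J)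
      ≈⟨ +-cong (lucas I q (ℕ.n<1+n q) J q (ℕ.n<1+n q))
                (trans (binom-≡ʳ (q ℕ.+ p ℕ.* I) (≡.sym (ℕ.*-suc p J))) (lucas I q (ℕ.n<1+n q) (suc J) 0 (s≤s z≤n))) ⟩
    binom q q * binom I J + 1# * binom I (suc J)
      ≈⟨ +-cong (trans (*-congʳ (binom-diag q)) (*-identityˡ _)) (*-identityˡ _) ⟩
    binom (suc I) (suc J)
      ≈⟨ *-identityˡ _ ⟨
    1# * binom (suc I) (suc J) ∎

  binom-p^s : ∀ s i → binom i (p ^ s) ≈ ⌜ digit p i s ⌝
  binom-p^s zero    i = trans (binom-1 i) (⌜⌝-mod i)
  binom-p^s (suc s) i = begin
    binom i (p ^ suc s)                             ≈⟨ binom-≡ˡ (p ^ suc s) i≡ ⟩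
    binom (i % p ℕ.+ p ℕ.* (i / p)) (0 ℕ.+ p ℕ.* p ^ s)
                                                    ≈⟨ lucas (i / p) (i % p) (m%n<n i p) (p ^ s) 0 (s≤s z≤n) ⟩
    binom (i % p) 0 * binom (i / p) (p ^ s)         ≈⟨ *-identityˡ _ ⟩
    binom (i / p) (p ^ s)                           ≈⟨ binom-p^s s (i / p) ⟩
    ⌜ digit p (i / p) s ⌝                           ∎
    where
    i≡ : i ≡ i % p ℕ.+ p ℕ.* (i / p)
    i≡ = ≡.trans (m≡m%n+[m/n]*n i p) (≡.cong (i % p ℕ.+_) (ℕ.*-comm (i / p) p))

module ExtArithmetic {a ℓ} (K : CommutativeRing a ℓ) (N : ℕ) (c : CommutativeRing.Carrier K) where
  open CommutativeRing K hiding (zero)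
  open Ext K N c
  open RingArithmetic K using (solve; _⊜_; _⊕_; _⊗_; _^ᴷ_; ^-homo-*; ^-congʳ)
  open import Data.Vec.Functional.Relation.Binary.Equality.Setoid setoid using (≋-setoid)
  ≈L-setoid : Setoid a ℓ
  ≈L-setoid = ≋-setoid N

  module ≈L = Setoid ≈L-setoid
  open import Relation.Binary.Reasoning.Setoid setoid
  open import Algebra.Properties.CommutativeSemigroup *-commutativeSemigroup using (x∙yz≈y∙xz)

  ΣK-cong : ∀ m {g h} → (∀ i → g i ≈ h i) → ΣK m g ≈ ΣK m h
  ΣK-cong zero    g≈h = refl
  ΣK-cong (suc m) g≈h = +-cong (g≈h Fin.zero) (ΣK-cong m (g≈h ∘ Fin.suc))

  ΣK-zero : ∀ m {g} → (∀ i → g i ≈ 0#) → ΣK m g ≈ 0#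
  ΣK-zero zero    g≈0 = refl
  ΣK-zero (suc m) g≈0 = trans (+-cong (g≈0 Fin.zero) (ΣK-zero m (g≈0 ∘ Fin.suc))) (+-identityˡ 0#)

  ΣK-δ : ∀ m {g} t {v} → t < m → (∀ j → toℕ j ≢ t → g j ≈ 0#) → (∀ j → toℕ j ≡ t → g j ≈ v) → ΣK m g ≈ v
  ΣK-δ (suc m) zero    _         g≈0 g≈v =
    trans (+-cong (g≈v Fin.zero ≡.refl) (ΣK-zero m (λ j → g≈0 (Fin.suc j) (λ ())))) (+-identityʳ _)
  ΣK-δ (suc m) (suc t) (s≤s t<m) g≈0 g≈v =
    trans (+-cong (g≈0 Fin.zero (λ ()))
                  (ΣK-δ m t t<m (λ j j≢t → g≈0 (Fin.suc j) (j≢t ∘ ℕ.suc-injective))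
                                (λ j j≡t → g≈v (Fin.suc j) (≡.cong suc j≡t))))
          (+-identityˡ _)

  ΣK-+ : ∀ m g h → ΣK m (λ i → g i + h i) ≈ ΣK m g + ΣK m h
  ΣK-+ zero    g h = sym (+-identityˡ 0#)
  ΣK-+ (suc m) g h = trans (+-congˡ (ΣK-+ m (g ∘ Fin.suc) (h ∘ Fin.suc)))
    (solve 4 (λ a b c d → ((a ⊕ b) ⊕ (c ⊕ d)) ⊜ ((a ⊕ c) ⊕ (b ⊕ d))) refl (g Fin.zero) (h Fin.zero) _ _)

  *-distribˡ-ΣK : ∀ m x g → x * ΣK m g ≈ ΣK m (λ i → x * g i)
  *-distribˡ-ΣK zero    x g = zeroʳ x
  *-distribˡ-ΣK (suc m) x g = trans (distribˡ x _ _) (+-congˡ (*-distribˡ-ΣK m x (g ∘ Fin.suc)))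

  ΣL-pointwise : ∀ m (G : Fin m → L) k → ΣL m G k ≡ ΣK m (λ i → G i k)
  ΣL-pointwise zero    G k = ≡.refl
  ΣL-pointwise (suc m) G k = ≡.cong (λ z → G Fin.zero k + z) (ΣL-pointwise m (G ∘ Fin.suc) k)

  -- The coefficient of x^k contributed by y x^i x^j, using x^N = c;
  -- the Booleans test i + j = k and i + j = k + N.
  contribution : Bool → Bool → Carrier → Carrier
  contribution b₁ b₂ y = if b₁ then y else if b₂ then c * y else 0#

  contribution-cong : ∀ b₁ b₂ {y z} → y ≈ z → contribution b₁ b₂ y ≈ contribution b₁ b₂ z
  contribution-cong true  _     y≈z = y≈z
  contribution-cong false true  y≈z = *-congˡ y≈z
  contribution-cong false false _   = refl

  contribution-+ : ∀ b₁ b₂ y z → contribution b₁ b₂ (y + z) ≈ contribution b₁ b₂ y + contribution b₁ b₂ z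
  contribution-+ true  _     y z = refl
  contribution-+ false true  y z = distribˡ c y z
  contribution-+ false false y z = sym (+-identityˡ 0#)

  contribution-* : ∀ b₁ b₂ x y → contribution b₁ b₂ (x * y) ≈ x * contribution b₁ b₂ y
  contribution-* true  _     x y = refl
  contribution-* false true  x y = solve 3 (λ c x y → (c ⊗ (x ⊗ y)) ⊜ (x ⊗ (c ⊗ y))) refl c x y
  contribution-* false false x y = sym (zeroʳ x)

  contribution-zero : ∀ b₁ b₂ {y} → y ≈ 0# → contribution b₁ b₂ y ≈ 0#
  contribution-zero b₁ b₂ y≈0 = trans (contribution-cong b₁ b₂ y≈0)
    (trans (contribution-cong b₁ b₂ (sym (zeroˡ 0#))) (trans (contribution-* b₁ b₂ 0# 0#) (zeroˡ _)))

  contribution-< : ∀ s (k : Fin N) {y z} → s < N → (s ≡ toℕ k → y ≈ z) → (s ≢ toℕ k → 0# ≈ z) →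
                   contribution (s ≡ᵇ toℕ k) (s ≡ᵇ toℕ k ℕ.+ N) y ≈ z
  contribution-< s k s<N hit miss with s ℕ.≟ toℕ k
  ... | yes s≡k rewrite ≡ᵇ-true s≡k = hit s≡k
  ... | no  s≢k rewrite ≡ᵇ-false s≢k | ≡ᵇ-false {s} {toℕ k ℕ.+ N} (ℕ.<⇒≢ (ℕ.<-≤-trans s<N (ℕ.m≤n+m N (toℕ k)))) =
    miss s≢k

  contribution-≥ : ∀ s (k : Fin N) {y z} → N ≤ s →
                   (s ≡ toℕ k ℕ.+ N → c * y ≈ z) → (s ≢ toℕ k ℕ.+ N → 0# ≈ z) →
                   contribution (s ≡ᵇ toℕ k) (s ≡ᵇ toℕ k ℕ.+ N) y ≈ z
  contribution-≥ s k N≤s hit miss rewrite ≡ᵇ-false {s} {toℕ k} (ℕ.>⇒≢ (ℕ.<-≤-trans (toℕ<n k) N≤s))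
    with s ℕ.≟ toℕ k ℕ.+ N
  ... | yes s≡k+N rewrite ≡ᵇ-true s≡k+N = hit s≡k+N
  ... | no  s≢k+N rewrite ≡ᵇ-false s≢k+N = miss s≢k+N

  lowHit highHit : Fin N → Fin N → Fin N → Bool
  lowHit  k i j = toℕ i ℕ.+ toℕ j ≡ᵇ toℕ k
  highHit k i j = toℕ i ℕ.+ toℕ j ≡ᵇ toℕ k ℕ.+ N

  mulTerm : L → L → Fin N → Fin N → Fin N → Carrier
  mulTerm u v k i j = contribution (lowHit k i j) (highHit k i j) (u i * v j)

  *L-cong : ∀ {u u′ v v′} → u ≈L u′ → v ≈L v′ → (u *L v) ≈L (u′ *L v′)
  *L-cong u≈u′ v≈v′ k = ΣK-cong N (λ i → ΣK-cong N (λ j →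
    contribution-cong (lowHit k i j) (highHit k i j) (*-cong (u≈u′ i) (v≈v′ j))))

  +L-cong : ∀ {u u′ v v′} → u ≈L u′ → v ≈L v′ → (u +L v) ≈L (u′ +L v′)
  +L-cong u≈u′ v≈v′ k = +-cong (u≈u′ k) (v≈v′ k)

  scale-cong : ∀ {α β u v} → α ≈ β → u ≈L v → scale α u ≈L scale β v
  scale-cong α≈β u≈v k = *-cong α≈β (u≈v k)

  *L-split : ∀ {u v u₁ v₁ u₂ v₂} →
             (∀ k i j → mulTerm u v k i j ≈ mulTerm u₁ v₁ k i j + mulTerm u₂ v₂ k i j) →
             (u *L v) ≈L ((u₁ *L v₁) +L (u₂ *L v₂))
  *L-split split k = trans (ΣK-cong N (λ i → trans (ΣK-cong N (split k i)) (ΣK-+ N _ _))) (ΣK-+ N _ _)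

  *L-scaled : ∀ {u v u′ v′} α → (∀ k i j → mulTerm u v k i j ≈ α * mulTerm u′ v′ k i j) →
              (u *L v) ≈L scale α (u′ *L v′)
  *L-scaled α scaled k = trans (ΣK-cong N (λ i → trans (ΣK-cong N (scaled k i)) (sym (*-distribˡ-ΣK N α _))))
                               (sym (*-distribˡ-ΣK N α _))

  *L-distribʳ : ∀ u v w → ((u +L v) *L w) ≈L ((u *L w) +L (v *L w))
  *L-distribʳ u v w = *L-split λ k i j →
    trans (contribution-cong (lowHit k i j) (highHit k i j) (distribʳ (w j) (u i) (v i)))
          (contribution-+ (lowHit k i j) (highHit k i j) _ _)

  *L-distribˡ : ∀ u v w → (w *L (u +L v)) ≈L ((w *L u) +L (w *L v))
  *L-distribˡ u v w = *L-split λ k i j →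
    trans (contribution-cong (lowHit k i j) (highHit k i j) (distribˡ (w i) (u j) (v j)))
          (contribution-+ (lowHit k i j) (highHit k i j) _ _)

  *L-scaleˡ : ∀ α u v → (scale α u *L v) ≈L scale α (u *L v)
  *L-scaleˡ α u v = *L-scaled α λ k i j →
    trans (contribution-cong (lowHit k i j) (highHit k i j) (*-assoc α (u i) (v j)))
          (contribution-* (lowHit k i j) (highHit k i j) α _)

  *L-scaleʳ : ∀ α u v → (u *L scale α v) ≈L scale α (u *L v)
  *L-scaleʳ α u v = *L-scaled α λ k i j →
    trans (contribution-cong (lowHit k i j) (highHit k i j) (x∙yz≈y∙xz (u i) α (v j)))
          (contribution-* (lowHit k i j) (highHit k i j) α _)

  *L-zeroʳ : ∀ u → (u *L 0L) ≈L 0L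
  *L-zeroʳ u k = ΣK-zero N (λ i → ΣK-zero N (λ j → contribution-zero (lowHit k i j) (highHit k i j) (zeroʳ (u i))))

  *L-zeroˡ : ∀ u → (0L *L u) ≈L 0L
  *L-zeroˡ u k = ΣK-zero N (λ i → ΣK-zero N (λ j → contribution-zero (lowHit k i j) (highHit k i j) (zeroˡ (u j))))

  scale-zeroˡ : ∀ u → scale 0# u ≈L 0L
  scale-zeroˡ u k = zeroˡ (u k)

  scale-identityˡ : ∀ u → scale 1# u ≈L u
  scale-identityˡ u k = *-identityˡ (u k)

  scale-distribʳ : ∀ α β u → (scale α u +L scale β u) ≈L scale (α + β) u
  scale-distribʳ α β u k = sym (distribʳ (u k) α β)

  +L-identityˡ : ∀ u → (0L +L u) ≈L u
  +L-identityˡ u k = +-identityˡ (u k)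

  +L-identityʳ : ∀ u → (u +L 0L) ≈L u
  +L-identityʳ u k = +-identityʳ (u k)

  eL-≢ : ∀ m k → toℕ k ≢ m → eL m k ≈ 0#
  eL-≢ m k k≢m rewrite ≡ᵇ-false k≢m = refl

  eL-≡ : ∀ m k → toℕ k ≡ m → eL m k ≈ 1#
  eL-≡ m k k≡m rewrite ≡ᵇ-true k≡m = refl

  scale-eL-≢ : ∀ α m k → toℕ k ≢ m → scale α (eL m) k ≈ 0#
  scale-eL-≢ α m k k≢m = trans (*-congˡ (eL-≢ m k k≢m)) (zeroʳ α)

  scale-eL-≡ : ∀ α m k → toℕ k ≡ m → scale α (eL m) k ≈ α
  scale-eL-≡ α m k k≡m = trans (*-congˡ (eL-≡ m k k≡m)) (*-identityʳ α)

  ΣΣ-δ : ∀ (G : Fin N → Fin N → Carrier) a b {v} → a < N → b < N →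
         (∀ i j → toℕ i ≢ a → G i j ≈ 0#) → (∀ i j → toℕ i ≡ a → toℕ j ≢ b → G i j ≈ 0#) →
         (∀ i j → toℕ i ≡ a → toℕ j ≡ b → G i j ≈ v) → ΣK N (λ i → ΣK N (G i)) ≈ v
  ΣΣ-δ G a b a<N b<N i≢a j≢b hit =
    ΣK-δ N a a<N (λ i i≢a′ → ΣK-zero N (λ j → i≢a i j i≢a′))
                 (λ i i≡a → ΣK-δ N b b<N (λ j → j≢b i j i≡a) (λ j → hit i j i≡a))

  scale-eL-*L : ∀ α β a b → a < N → b < N → ∀ k →
                (scale α (eL a) *L scale β (eL b)) k
                  ≈ contribution (a ℕ.+ b ≡ᵇ toℕ k) (a ℕ.+ b ≡ᵇ toℕ k ℕ.+ N) (α * β)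
  scale-eL-*L α β a b a<N b<N k = ΣΣ-δ (mulTerm (scale α (eL a)) (scale β (eL b)) k) a b a<N b<N
    (λ i j i≢a → contribution-zero (lowHit k i j) (highHit k i j) (trans (*-congʳ (scale-eL-≢ α a i i≢a)) (zeroˡ _)))
    (λ i j _ j≢b → contribution-zero (lowHit k i j) (highHit k i j) (trans (*-congˡ (scale-eL-≢ β b j j≢b)) (zeroʳ _)))
    (λ { i j ≡.refl ≡.refl → contribution-cong (lowHit k i j) (highHit k i j)
                               (*-cong (scale-eL-≡ α _ i ≡.refl) (scale-eL-≡ β _ j ≡.refl)) })

  scale-eL-*L-< : ∀ α β a b → a < N → b < N → a ℕ.+ b < N →
                  (scale α (eL a) *L scale β (eL b)) ≈L scale (α * β) (eL (a ℕ.+ b))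
  scale-eL-*L-< α β a b a<N b<N a+b<N k = trans (scale-eL-*L α β a b a<N b<N k)
    (contribution-< (a ℕ.+ b) k a+b<N (λ a+b≡k → sym (scale-eL-≡ _ _ k (≡.sym a+b≡k)))
                                      (λ a+b≢k → sym (scale-eL-≢ _ _ k (a+b≢k ∘ ≡.sym))))

  scale-eL-*L-≥ : ∀ α β a b → a < N → b < N → N ≤ a ℕ.+ b →
                  (scale α (eL a) *L scale β (eL b)) ≈L scale (c * (α * β)) (eL (a ℕ.+ b ∸ N))
  scale-eL-*L-≥ α β a b a<N b<N N≤a+b k = trans (scale-eL-*L α β a b a<N b<N k)
    (contribution-≥ (a ℕ.+ b) k N≤a+b (λ a+b≡k+N → sym (scale-eL-≡ _ _ k (k≡ a+b≡k+N)))
                                      (λ a+b≢k+N → sym (scale-eL-≢ _ _ k (a+b≢k+N ∘ k+N≡))))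
    where
    k≡ : a ℕ.+ b ≡ toℕ k ℕ.+ N → toℕ k ≡ a ℕ.+ b ∸ N
    k≡ e = ≡.sym (≡.trans (≡.cong (_∸ N) e) (ℕ.m+n∸n≡m (toℕ k) N))
    k+N≡ : toℕ k ≡ a ℕ.+ b ∸ N → a ℕ.+ b ≡ toℕ k ℕ.+ N
    k+N≡ e = ≡.sym (≡.trans (≡.cong (ℕ._+ N) e) (ℕ.m∸n+n≡m N≤a+b))

  _+LA_ : LA → LA → LA
  (U +LA V) b = U b +L V b

  tensorTerm : LA → LA → Fin N → Fin N → Fin N → Fin N → Carrier
  tensorTerm U V b k i j = (if toℕ i ℕ.+ toℕ j ≡ᵇ toℕ b then U i *L V j else 0L) k

  *LA-pointwise : ∀ U V b k → (U *LA V) b k ≈ ΣK N (λ i → ΣK N (tensorTerm U V b k i))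
  *LA-pointwise U V b k = trans (reflexive (ΣL-pointwise N _ k)) (ΣK-cong N (λ i → reflexive (ΣL-pointwise N _ k)))

  tensorTerm-zero : ∀ U V b k i j → (toℕ i ℕ.+ toℕ j ≢ toℕ b ⊎ U i ≈L 0L) → tensorTerm U V b k i j ≈ 0#
  tensorTerm-zero U V b k i j miss with toℕ i ℕ.+ toℕ j ≡ᵇ toℕ b in hit
  ... | false = refl
  ... | true with miss
  ...   | inj₁ i+j≢b = ⊥-elim (i+j≢b (ℕ.≡ᵇ⇒≡ _ _ (Equivalence.from T-≡ hit)))
  ...   | inj₂ Ui≈0  = ≈L.trans (*L-cong Ui≈0 ≈L.refl) (*L-zeroˡ (V j)) k

  *LA-distribʳ : ∀ U₁ U₂ V b → ((U₁ +LA U₂) *LA V) b ≈L ((U₁ *LA V) b +L (U₂ *LA V) b)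
  *LA-distribʳ U₁ U₂ V b k = begin
    ((U₁ +LA U₂) *LA V) b k
      ≈⟨ *LA-pointwise (U₁ +LA U₂) V b k ⟩
    ΣK N (λ i → ΣK N (tensorTerm (U₁ +LA U₂) V b k i))
      ≈⟨ ΣK-cong N (λ i → trans (ΣK-cong N (split i)) (ΣK-+ N _ _)) ⟩
    ΣK N (λ i → ΣK N (tensorTerm U₁ V b k i) + ΣK N (tensorTerm U₂ V b k i))
      ≈⟨ ΣK-+ N _ _ ⟩
    ΣK N (λ i → ΣK N (tensorTerm U₁ V b k i)) + ΣK N (λ i → ΣK N (tensorTerm U₂ V b k i))
      ≈⟨ +-cong (*LA-pointwise U₁ V b k) (*LA-pointwise U₂ V b k) ⟨
    (U₁ *LA V) b k + (U₂ *LA V) b k ∎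
    where
    split : ∀ i j → tensorTerm (U₁ +LA U₂) V b k i j ≈ tensorTerm U₁ V b k i j + tensorTerm U₂ V b k i j
    split i j with toℕ i ℕ.+ toℕ j ≡ᵇ toℕ b
    ... | true  = *L-distribʳ (U₁ i) (U₂ i) (V j) k
    ... | false = sym (+-identityˡ 0#)

  *LA-vanishing : ∀ U V b → (∀ i → toℕ i ≤ toℕ b → U i ≈L 0L) → (U *LA V) b ≈L 0L
  *LA-vanishing U V b U≈0 k = trans (*LA-pointwise U V b k)
    (ΣK-zero N (λ i → ΣK-zero N (λ j → tensorTerm-zero U V b k i j (miss i j))))
    where
    miss : ∀ i j → toℕ i ℕ.+ toℕ j ≢ toℕ b ⊎ U i ≈L 0L
    miss i j with toℕ i ℕ.+ toℕ j ℕ.≟ toℕ b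
    ... | yes i+j≡b = inj₂ (U≈0 i (≡.subst (toℕ i ≤_) i+j≡b (ℕ.m≤m+n (toℕ i) (toℕ j))))
    ... | no  i+j≢b = inj₁ i+j≢b

  *LA-single : ∀ U V b a j → toℕ a ℕ.+ toℕ j ≡ toℕ b →
               (∀ i → toℕ i ≢ toℕ a → toℕ i ≤ toℕ b → U i ≈L 0L) → (U *LA V) b ≈L (U a *L V j)
  *LA-single U V b a j a+j≡b U≈0 k = trans (*LA-pointwise U V b k)
    (ΣΣ-δ (tensorTerm U V b k) (toℕ a) (toℕ j) (toℕ<n a) (toℕ<n j)
      (λ i j′ i≢a → tensorTerm-zero U V b k i j′ (miss i j′ i≢a))
      (λ i j′ i≡a j′≢j → tensorTerm-zero U V b k i j′
        (inj₁ (λ i+j′≡b → j′≢j (ℕ.+-cancelˡ-≡ (toℕ a) _ _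
                 (≡.trans (≡.cong (ℕ._+ toℕ j′) (≡.sym i≡a)) (≡.trans i+j′≡b (≡.sym a+j≡b)))))))
      hit)
    where
    miss : ∀ i j′ → toℕ i ≢ toℕ a → toℕ i ℕ.+ toℕ j′ ≢ toℕ b ⊎ U i ≈L 0L
    miss i j′ i≢a with toℕ i ℕ.+ toℕ j′ ℕ.≟ toℕ b
    ... | yes i+j′≡b = inj₂ (U≈0 i i≢a (≡.subst (toℕ i ≤_) i+j′≡b (ℕ.m≤m+n (toℕ i) (toℕ j′))))
    ... | no  i+j′≢b = inj₁ i+j′≢b
    hit : ∀ i j′ → toℕ i ≡ toℕ a → toℕ j′ ≡ toℕ j → tensorTerm U V b k i j′ ≈ (U a *L V j) k
    hit i j′ i≡a j′≡j rewrite toℕ-injective i≡a | toℕ-injective j′≡j | ≡ᵇ-true a+j≡b = refl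

  select-≢ : ∀ (b : Fin N) m u → toℕ b ≢ m → (if toℕ b ≡ᵇ m then u else 0L) ≈L 0L
  select-≢ b m u b≢m rewrite ≡ᵇ-false b≢m = ≈L.refl

  select-≡ : ∀ (b : Fin N) m u → toℕ b ≡ m → (if toℕ b ≡ᵇ m then u else 0L) ≈L u
  select-≡ b m u b≡m rewrite ≡ᵇ-true b≡m = ≈L.refl

  sumRange-step : ∀ lo hi (g : ℕ → L) → lo ≤ hi → sumRange 0L _+L_ lo hi g ≡ (g lo +L sumRange 0L _+L_ (suc lo) hi g)
  sumRange-step lo hi g lo≤hi rewrite ℕ.+-∸-assoc 1 lo≤hi = ≡.refl

  sumRange-empty : ∀ lo hi (g : ℕ → L) → hi < lo → sumRange 0L _+L_ lo hi g ≡ 0L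
  sumRange-empty lo hi g hi<lo rewrite ℕ.m≤n⇒m∸n≡0 hi<lo = ≡.refl

  sumRange-zero : ∀ lo hi (g : ℕ → L) → (∀ l → lo ≤ l → l ≤ hi → g l ≈L 0L) → sumRange 0L _+L_ lo hi g ≈L 0L
  sumRange-zero lo hi g g≈0 = go (suc hi ∸ lo) lo ≡.refl (λ l lo≤l → g≈0 l lo≤l)
    where
    go : ∀ m lo → suc hi ∸ lo ≡ m → (∀ l → lo ≤ l → l ≤ hi → g l ≈L 0L) → sumRange 0L _+L_ lo hi g ≈L 0L
    go m lo len g≈0 with lo ℕ.≤? hi
    ... | no lo≰hi = ≈L.reflexive (sumRange-empty lo hi g (ℕ.≰⇒> lo≰hi))
    go zero    lo len g≈0 | yes lo≤hi = ⊥-elim (ℕ.<⇒≱ (s≤s lo≤hi) (ℕ.m∸n≡0⇒m≤n len))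
    go (suc m) lo len g≈0 | yes lo≤hi = ≈L.trans (≈L.reflexive (sumRange-step lo hi g lo≤hi))
      (≈L.trans (+L-cong (g≈0 lo ℕ.≤-refl lo≤hi)
                         (go m (suc lo) (ℕ.suc-injective (≡.trans (≡.sym (ℕ.+-∸-assoc 1 lo≤hi)) len))
                             (λ l lo<l → g≈0 l (ℕ.<⇒≤ lo<l))))
               (+L-identityˡ 0L))

  sumRange-single : ∀ lo hi (g : ℕ → L) l₀ → lo ≤ l₀ → l₀ ≤ hi →
                    (∀ l → lo ≤ l → l ≤ hi → l ≢ l₀ → g l ≈L 0L) →
                    sumRange 0L _+L_ lo hi g ≈L g l₀
  sumRange-single lo hi g l₀ lo≤l₀ l₀≤hi g≈0 = go (suc hi ∸ lo) lo ≡.refl lo≤l₀ (λ l lo≤l → g≈0 l lo≤l)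
    where
    go : ∀ m lo → suc hi ∸ lo ≡ m → lo ≤ l₀ → (∀ l → lo ≤ l → l ≤ hi → l ≢ l₀ → g l ≈L 0L) →
         sumRange 0L _+L_ lo hi g ≈L g l₀
    go zero    lo len lo≤l₀ g≈0 = ⊥-elim (ℕ.<⇒≱ (s≤s (ℕ.≤-trans lo≤l₀ l₀≤hi)) (ℕ.m∸n≡0⇒m≤n len))
    go (suc m) lo len lo≤l₀ g≈0 with lo ℕ.≟ l₀
    ... | yes ≡.refl = ≈L.trans (≈L.reflexive (sumRange-step lo hi g l₀≤hi))
      (≈L.trans (+L-cong ≈L.refl (sumRange-zero (suc lo) hi g
                                    (λ l lo<l l≤hi → g≈0 l (ℕ.<⇒≤ lo<l) l≤hi (ℕ.>⇒≢ lo<l))))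
               (+L-identityʳ (g lo)))
    ... | no lo≢l₀ = ≈L.trans (≈L.reflexive (sumRange-step lo hi g lo≤hi))
      (≈L.trans (+L-cong (g≈0 lo ℕ.≤-refl lo≤hi lo≢l₀)
                        (go m (suc lo) (ℕ.suc-injective (≡.trans (≡.sym (ℕ.+-∸-assoc 1 lo≤hi)) len))
                            (ℕ.≤∧≢⇒< lo≤l₀ lo≢l₀) (λ l lo<l → g≈0 l (ℕ.<⇒≤ lo<l))))
               (+L-identityˡ (g l₀)))
      where lo≤hi = ℕ.≤-trans lo≤l₀ l₀≤hi

  module _ (1<N : 1 < N) where

    instance
      N≢0 : NonZero N
      N≢0 = ℕ.>-nonZero (ℕ.<-trans (s≤s z≤n) 1<N)

    -- _*L_ is never shown associative: powers of x are multiplied through their normal form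
    -- c^(m / N) x^(m % N).
    normalForm : ℕ → L
    normalForm m = scale (c ^ᴷ (m / N)) (eL (m % N))

    normalForm-≡ : ∀ m t k → t < N → m ≡ t ℕ.+ k ℕ.* N → normalForm m ≈L scale (c ^ᴷ k) (eL t)
    normalForm-≡ _ t k t<N ≡.refl = scale-cong (^-congʳ c quotient≡) (≈L.reflexive (≡.cong eL remainder≡))
      where
      remainder≡ : (t ℕ.+ k ℕ.* N) % N ≡ t
      remainder≡ = ≡.trans ([m+kn]%n≡m%n t k N) (m<n⇒m%n≡m t<N)
      quotient≡ : (t ℕ.+ k ℕ.* N) / N ≡ k
      quotient≡ = ≡.trans (+-distrib-/ t (k ℕ.* N) (≡.subst (_< N) lemma t<N))
                          (≡.cong₂ ℕ._+_ (m<n⇒m/n≡0 t<N) (m*n/n≡m k N))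
        where
        lemma : t ≡ t % N ℕ.+ (k ℕ.* N) % N
        lemma = ≡.sym (≡.trans (≡.cong₂ ℕ._+_ (m<n⇒m%n≡m t<N) (m*n%n≡0 k N)) (ℕ.+-identityʳ t))

    divMod-+ : ∀ a b → a ℕ.+ b ≡ (a % N ℕ.+ b % N) ℕ.+ (a / N ℕ.+ b / N) ℕ.* N
    divMod-+ a b = ≡.trans (≡.cong₂ ℕ._+_ (m≡m%n+[m/n]*n a N) (m≡m%n+[m/n]*n b N))
      (NS.solve 5 (λ x y u v n → (x NS.:+ u NS.:* n) NS.:+ (y NS.:+ v NS.:* n) NS.:= (x NS.:+ y) NS.:+ (u NS.:+ v) NS.:* n)
        ≡.refl (a % N) (b % N) (a / N) (b / N) N)

    normalForm-+ : ∀ a b → (normalForm a *L normalForm b) ≈L normalForm (a ℕ.+ b)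
    normalForm-+ a b with a % N ℕ.+ b % N ℕ.<? N
    ... | yes no-carry = ≈L.trans
      (scale-eL-*L-< _ _ _ _ (m%n<n a N) (m%n<n b N) no-carry)
      (≈L.sym (≈L.trans (normalForm-≡ (a ℕ.+ b) _ (a / N ℕ.+ b / N) no-carry (divMod-+ a b))
                      (scale-cong (^-homo-* c (a / N) (b / N)) ≈L.refl)))
    ... | no  carry = ≈L.trans
      (scale-eL-*L-≥ _ _ _ _ (m%n<n a N) (m%n<n b N) N≤)
      (≈L.sym (≈L.trans (normalForm-≡ (a ℕ.+ b) _ (suc (a / N ℕ.+ b / N)) wrapped<N a+b≡)
                      (scale-cong (*-congˡ (^-homo-* c (a / N) (b / N))) ≈L.refl)))
      where
      N≤ : N ≤ a % N ℕ.+ b % N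
      N≤ = ℕ.≮⇒≥ carry
      wrapped<N : a % N ℕ.+ b % N ∸ N < N
      wrapped<N = ℕ.+-cancelʳ-< _ _ N (≡.subst (_< N ℕ.+ N) (≡.sym (ℕ.m∸n+n≡m N≤))
                    (ℕ.+-mono-< (m%n<n a N) (m%n<n b N)))
      a+b≡ : a ℕ.+ b ≡ (a % N ℕ.+ b % N ∸ N) ℕ.+ suc (a / N ℕ.+ b / N) ℕ.* N
      a+b≡ = ≡.trans (divMod-+ a b) (≡.trans (≡.cong (ℕ._+ (a / N ℕ.+ b / N) ℕ.* N) (≡.sym (ℕ.m∸n+n≡m N≤)))
               (NS.solve 3 (λ t n w → (t NS.:+ n) NS.:+ w NS.:* n NS.:= t NS.:+ (NS.con 1 NS.:+ w) NS.:* n)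
                 ≡.refl (a % N ℕ.+ b % N ∸ N) N (a / N ℕ.+ b / N)))

    eL-normalForm : ∀ t → t < N → eL t ≈L normalForm t
    eL-normalForm t t<N = ≈L.sym (≈L.trans (normalForm-≡ t t 0 t<N (≡.sym (ℕ.+-identityʳ t))) (scale-identityˡ (eL t)))

    powL-normalForm : ∀ m → powL (eL 1) m ≈L normalForm m
    powL-normalForm zero    = eL-normalForm 0 (ℕ.<-trans (s≤s z≤n) 1<N)
    powL-normalForm (suc m) = ≈L.trans (*L-cong (eL-normalForm 1 1<N) (powL-normalForm m)) (normalForm-+ 1 m)

    powL-+ : ∀ a b → (powL (eL 1) a *L powL (eL 1) b) ≈L powL (eL 1) (a ℕ.+ b)
    powL-+ a b = ≈L.trans (*L-cong (powL-normalForm a) (powL-normalForm b))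
                         (≈L.trans (normalForm-+ a b) (≈L.sym (powL-normalForm (a ℕ.+ b))))

    1L-*L : ∀ u → (1L *L u) ≈L u
    1L-*L u k = ΣΣ-δ (mulTerm 1L u k) 0 (toℕ k) (ℕ.<-trans (s≤s z≤n) 1<N) (toℕ<n k)
      (λ i j i≢0 → contribution-zero (lowHit k i j) (highHit k i j) (trans (*-congʳ (eL-≢ 0 i i≢0)) (zeroˡ _)))
      (λ i j i≡0 j≢k → contribution-< _ k (s<N i j i≡0) (λ s≡k → ⊥-elim (j≢k (≡.trans (≡.sym (s≡j i j i≡0)) s≡k)))
                                                           (λ _ → refl))
      (λ i j i≡0 j≡k → contribution-< _ k (s<N i j i≡0)
        (λ _ → trans (*-congʳ (eL-≡ 0 i i≡0)) (trans (*-identityˡ _) (reflexive (≡.cong u (toℕ-injective j≡k)))))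
        (λ s≢k → ⊥-elim (s≢k (≡.trans (s≡j i j i≡0) j≡k))))
      where
      s≡j : ∀ (i j : Fin N) → toℕ i ≡ 0 → toℕ i ℕ.+ toℕ j ≡ toℕ j
      s≡j i j i≡0 = ≡.cong (ℕ._+ toℕ j) i≡0
      s<N : ∀ (i j : Fin N) → toℕ i ≡ 0 → toℕ i ℕ.+ toℕ j < N
      s<N i j i≡0 = ≡.subst (_< N) (≡.sym (s≡j i j i≡0)) (toℕ<n j)

module Coaction {a ℓ} (K : CommutativeRing a ℓ) (q n : ℕ) (c cinv f : CommutativeRing.Carrier K)
                (inv : ℕ → CommutativeRing.Carrier K) (1≤q : 1 ≤ q) (2≤n : 2 ≤ n) where
  open CommutativeRing K hiding (zero)
  open RingArithmetic K using (binom; binom-≡ʳ; binom->; ⌜_⌝; solve; _⊜_; _⊕_; _⊗_)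
  open Setup K (suc q) n c cinv f inv
  open ExtArithmetic K N c
  open import Relation.Binary.Reasoning.Setoid ≈L-setoid

  p : ℕ
  p = suc q

  R : ℕ
  R = p ^ r

  M : ℕ
  M = R ℕ.* q

  g : Carrier
  g = f * inv q

  x^_ : ℕ → L
  x^ m = powL x m

  1<p^ : ∀ m → 1 ≤ m → 1 < p ^ m
  1<p^ m 1≤m = ℕ.<-≤-trans (s≤s 1≤q) (≡.subst (_≤ p ^ m) (ℕ.*-identityʳ p) (ℕ.^-monoʳ-≤ p 1≤m))

  n≡1+r : n ≡ suc r
  n≡1+r = ≡.sym (ℕ.suc-pred n {{ℕ.>-nonZero (ℕ.<-trans (s≤s z≤n) 2≤n)}})

  1<R : 1 < R
  1<R = 1<p^ r (ℕ.∸-monoˡ-≤ 1 2≤n)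

  1<N : 1 < N
  1<N = 1<p^ n (ℕ.<⇒≤ 2≤n)

  R<N : R < N
  R<N = ≡.subst (λ m → R < p ^ m) (≡.sym n≡1+r) (ℕ.^-monoʳ-< p (s≤s 1≤q) (ℕ.n<1+n r))

  1≤M : 1 ≤ M
  1≤M = ℕ.*-mono-≤ (ℕ.<⇒≤ 1<R) 1≤q

  -- αx is definitionally x⊗1 +LA (1⊗t +LA deformation).
  x⊗1 1⊗t deformation : LA
  x⊗1 b = if toℕ b ≡ᵇ 0 then x else 0L
  1⊗t b = if toℕ b ≡ᵇ 1 then 1L else 0L
  deformation b = sumRange 0L _+L_ 1 q λ l →
    if toℕ b ≡ᵇ R ℕ.* (p ∸ l) then scale (f * inv l) (x^ (R ℕ.* l)) else 0L

  p∸l≡1+q∸l : ∀ l → l ≤ q → p ∸ l ≡ suc (q ∸ l)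
  p∸l≡1+q∸l l l≤q = ℕ.+-∸-assoc 1 l≤q

  deformation-below : ∀ (b : Fin N) → toℕ b < R → deformation b ≈L 0L
  deformation-below b b<R = sumRange-zero 1 q _ λ l _ l≤q →
    select-≢ b (R ℕ.* (p ∸ l)) _ (ℕ.<⇒≢ (ℕ.<-≤-trans b<R (R≤ l l≤q)))
    where
    R≤ : ∀ l → l ≤ q → R ≤ R ℕ.* (p ∸ l)
    R≤ l l≤q rewrite p∸l≡1+q∸l l l≤q = ℕ.m≤m*n R (suc (q ∸ l))

  deformation-at : ∀ (b : Fin N) → toℕ b ≡ R → deformation b ≈L scale g (x^ M)
  deformation-at b b≡R = ≈L.trans
    (sumRange-single 1 q _ q 1≤q ℕ.≤-refl λ l _ l≤q l≢q →
      select-≢ b (R ℕ.* (p ∸ l)) _ (l≢q ∘′ only-q l l≤q ∘′ ≡.trans (≡.sym b≡R)))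
    (select-≡ b (R ℕ.* (p ∸ q)) _ b≡R*[p∸q])
    where
    b≡R*[p∸q] : toℕ b ≡ R ℕ.* (p ∸ q)
    b≡R*[p∸q] = ≡.trans b≡R (≡.trans (≡.sym (ℕ.*-identityʳ R)) (≡.cong (R ℕ.*_) (≡.sym (ℕ.m+n∸n≡m 1 q))))
    only-q : ∀ l → l ≤ q → R ≡ R ℕ.* (p ∸ l) → l ≡ q
    only-q l l≤q R≡ = ℕ.≤-antisym l≤q (ℕ.m∸n≡0⇒m≤n (ℕ.suc-injective
      (≡.trans (≡.sym (p∸l≡1+q∸l l l≤q)) (ℕ.*-cancelˡ-≡ (p ∸ l) 1 R {{ℕ.>-nonZero (ℕ.<-trans (s≤s z≤n) 1<R)}}
        (≡.trans (≡.sym R≡) (≡.sym (ℕ.*-identityʳ R)))))))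

  0F 1F : Fin N
  0F = fromℕ< (ℕ.<-trans (s≤s z≤n) 1<N)
  1F = fromℕ< 1<N

  toℕ-0F : toℕ 0F ≡ 0
  toℕ-0F = toℕ-fromℕ< _

  toℕ-1F : toℕ 1F ≡ 1
  toℕ-1F = toℕ-fromℕ< 1<N

  x⊗1-*LA : ∀ V b → (x⊗1 *LA V) b ≈L (x *L V b)
  x⊗1-*LA V b = ≈L.trans
    (*LA-single x⊗1 V b 0F b (≡.cong (ℕ._+ toℕ b) toℕ-0F)
                (λ i i≢0F _ → select-≢ i 0 x (λ i≡0 → i≢0F (≡.trans i≡0 (≡.sym toℕ-0F)))))
    (*L-cong (select-≡ 0F 0 x toℕ-0F) ≈L.refl)

  1⊗t-*LA-0 : ∀ V b → toℕ b ≡ 0 → (1⊗t *LA V) b ≈L 0L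
  1⊗t-*LA-0 V b b≡0 = *LA-vanishing 1⊗t V b λ i i≤b →
    select-≢ i 1 1L λ i≡1 → ℕ.<⇒≱ (s≤s z≤n) (≡.subst₂ _≤_ i≡1 b≡0 i≤b)

  1⊗t-*LA-suc : ∀ V b b′ → toℕ b ≡ suc (toℕ b′) → (1⊗t *LA V) b ≈L V b′
  1⊗t-*LA-suc V b b′ b≡1+b′ = ≈L.trans
    (*LA-single 1⊗t V b 1F b′ (≡.trans (≡.cong (ℕ._+ toℕ b′) toℕ-1F) (≡.sym b≡1+b′))
                (λ i i≢1F _ → select-≢ i 1 1L (λ i≡1 → i≢1F (≡.trans i≡1 (≡.sym toℕ-1F)))))
    (≈L.trans (*L-cong (select-≡ 1F 1 1L toℕ-1F) ≈L.refl) (1L-*L 1<N (V b′)))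

  deformation-*LA-below : ∀ V b → toℕ b < R → (deformation *LA V) b ≈L 0L
  deformation-*LA-below V b b<R = *LA-vanishing deformation V b λ i i≤b → deformation-below i (ℕ.≤-<-trans i≤b b<R)

  deformation-*LA-at : ∀ V b → toℕ b ≡ R → (deformation *LA V) b ≈L (scale g (x^ M) *L V 0F)
  deformation-*LA-at V b b≡R = ≈L.trans
    (*LA-single deformation V b b 0F (≡.trans (≡.cong (toℕ b ℕ.+_) toℕ-0F) (ℕ.+-identityʳ _))
                (λ i i≢b i≤b → deformation-below i (≡.subst (toℕ i <_) b≡R (ℕ.≤∧≢⇒< i≤b i≢b))))
    (*L-cong (deformation-at b b≡R) ≈L.refl)

  αx-*LA : ∀ V b → (αx *LA V) b ≈L ((x *L V b) +L ((1⊗t *LA V) b +L (deformation *LA V) b))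
  αx-*LA V b = ≈L.trans (*LA-distribʳ x⊗1 (1⊗t +LA deformation) V b)
    (+L-cong (x⊗1-*LA V b) (*LA-distribʳ 1⊗t deformation V b))

  x*L-binomialTerm : ∀ i m → (x *L scale (binom i m) (x^ (i ∸ m))) ≈L scale (binom i m) (x^ (suc i ∸ m))
  x*L-binomialTerm i m with m ℕ.≤? i
  ... | yes m≤i = ≈L.trans (*L-scaleʳ _ x _) (scale-cong refl (≈L.reflexive (≡.cong x^_ (≡.sym (ℕ.+-∸-assoc 1 m≤i)))))
  ... | no  m≰i = ≈L.trans (*L-cong ≈L.refl vanishes) (≈L.trans (*L-zeroʳ x) (≈L.sym vanishes))
    where
    vanishes : ∀ {u} → scale (binom i m) u ≈L 0L
    vanishes {u} = ≈L.trans (scale-cong (binom-> (ℕ.≰⇒> m≰i)) ≈L.refl) (scale-zeroˡ u)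

  BinomialBelow : ℕ → Set ℓ
  BinomialBelow i = ∀ b {m} → toℕ b ≡ m → m < R → αpow i b ≈L scale (binom i m) (x^ (i ∸ m))

  BinomialAt : ℕ → Set ℓ
  BinomialAt i = ∀ b → toℕ b ≡ R →
    αpow i b ≈L (scale (binom i R) (x^ (i ∸ R)) +L scale (⌜ i ⌝ * g) (x^ (M ℕ.+ i ∸ 1)))

  binomialBelow-zero : BinomialBelow 0
  binomialBelow-zero b {zero}  b≡0   _ = ≈L.trans (select-≡ b 0 1L b≡0) (≈L.sym (scale-identityˡ (x^ 0)))
  binomialBelow-zero b {suc m} b≡1+m _ = ≈L.trans (select-≢ b 0 1L (λ b≡0 → ℕ.0≢1+n (≡.trans (≡.sym b≡0) b≡1+m)))
                                                  (≈L.sym (scale-zeroˡ (x^ 0)))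

  binomialAt-zero : BinomialAt 0
  binomialAt-zero b b≡R = ≈L.trans
    (select-≢ b 0 1L (λ b≡0 → ℕ.<⇒≢ (ℕ.<-trans (s≤s z≤n) 1<R) (≡.trans (≡.sym b≡0) b≡R)))
    (≈L.sym (≈L.trans (+L-cong (≈L.trans (scale-cong (binom-> (ℕ.<-trans (s≤s z≤n) 1<R)) ≈L.refl) (scale-zeroˡ _))
                               (≈L.trans (scale-cong (zeroˡ g) ≈L.refl) (scale-zeroˡ _)))
                      (+L-identityˡ 0L)))

  binomialBelow-suc : ∀ i → BinomialBelow i → BinomialBelow (suc i)
  binomialBelow-suc i below b {zero} b≡0 b<R = begin
    (αx *LA αpow i) b                                   ≈⟨ αx-*LA (αpow i) b ⟩
    (x *L αpow i b) +L ((1⊗t *LA αpow i) b +L (deformation *LA αpow i) b)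
      ≈⟨ +L-cong (*L-cong ≈L.refl (below b b≡0 b<R))
                 (+L-cong (1⊗t-*LA-0 (αpow i) b b≡0)
                          (deformation-*LA-below (αpow i) b (≡.subst (_< R) (≡.sym b≡0) b<R))) ⟩
    (x *L scale 1# (x^ i)) +L (0L +L 0L)                ≈⟨ +L-cong (x*L-binomialTerm i 0) (+L-identityˡ 0L) ⟩
    scale 1# (x^ suc i) +L 0L                           ≈⟨ +L-identityʳ _ ⟩
    scale 1# (x^ suc i)                                 ∎
  binomialBelow-suc i below b {suc m} b≡1+m 1+m<R = begin
    (αx *LA αpow i) b                                   ≈⟨ αx-*LA (αpow i) b ⟩
    (x *L αpow i b) +L ((1⊗t *LA αpow i) b +L (deformation *LA αpow i) b)
      ≈⟨ +L-cong (*L-cong ≈L.refl (below b b≡1+m 1+m<R))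
                 (+L-cong (1⊗t-*LA-suc (αpow i) b b′ (≡.trans b≡1+m (≡.cong suc (≡.sym b′≡m))))
                          (deformation-*LA-below (αpow i) b (≡.subst (_< R) (≡.sym b≡1+m) 1+m<R))) ⟩
    (x *L scale (binom i (suc m)) (x^ (i ∸ suc m))) +L (αpow i b′ +L 0L)
      ≈⟨ +L-cong (x*L-binomialTerm i (suc m)) (≈L.trans (+L-identityʳ _) (below b′ b′≡m m<R)) ⟩
    scale (binom i (suc m)) (x^ (i ∸ m)) +L scale (binom i m) (x^ (i ∸ m))
      ≈⟨ scale-distribʳ _ _ _ ⟩
    scale (binom i (suc m) + binom i m) (x^ (i ∸ m))
      ≈⟨ scale-cong (+-comm _ _) ≈L.refl ⟩
    scale (binom (suc i) (suc m)) (x^ (suc i ∸ suc m))  ∎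
    where
    m<R = ℕ.<-trans (ℕ.n<1+n m) 1+m<R
    b′ = fromℕ< (ℕ.<-trans m<R R<N)
    b′≡m = toℕ-fromℕ< (ℕ.<-trans m<R R<N)

  R≡1+[R-1] : R ≡ suc (R ∸ 1)
  R≡1+[R-1] = ≡.sym (ℕ.suc-pred R {{ℕ.>-nonZero (ℕ.<-trans (s≤s z≤n) 1<R)}})

  x*L-x^[M+i-1] : ∀ α i → (x *L scale α (x^ (M ℕ.+ i ∸ 1))) ≈L scale α (x^ (M ℕ.+ i))
  x*L-x^[M+i-1] α i = ≈L.trans (*L-scaleʳ α x _) (scale-cong refl (≈L.reflexive (≡.cong x^_
    (≡.sym (ℕ.+-∸-assoc 1 (ℕ.≤-trans 1≤M (ℕ.m≤m+n M i)))))))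

  g·x^M*L-x^i : ∀ i → (scale g (x^ M) *L scale 1# (x^ i)) ≈L scale g (x^ (M ℕ.+ i))
  g·x^M*L-x^i i = ≈L.trans (*L-scaleˡ g _ _) (scale-cong refl
    (≈L.trans (*L-scaleʳ 1# _ _) (≈L.trans (scale-identityˡ _) (powL-+ 1<N M i))))

  collect-at-R : ∀ i →
    ((scale (binom i R) (x^ (suc i ∸ R)) +L scale (⌜ i ⌝ * g) (x^ (M ℕ.+ i)))
       +L (scale (binom i (R ∸ 1)) (x^ (i ∸ (R ∸ 1))) +L scale g (x^ (M ℕ.+ i))))
    ≈L (scale (binom (suc i) R) (x^ (suc i ∸ R)) +L scale (⌜ suc i ⌝ * g) (x^ (M ℕ.+ suc i ∸ 1)))
  collect-at-R i k =
    trans (+-congˡ (+-congʳ (*-congˡ (reflexive (≡.cong (λ m → (x^ (suc i ∸ m)) k) (≡.sym R≡1+[R-1]))))))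
      (trans (solve 6 (λ a P n Q a′ g → ((a ⊗ P ⊕ n ⊗ Q) ⊕ (a′ ⊗ P ⊕ g ⊗ Q)) ⊜ ((a′ ⊕ a) ⊗ P ⊕ (g ⊕ n) ⊗ Q))
                      refl (binom i R) ((x^ (suc i ∸ R)) k) (⌜ i ⌝ * g) ((x^ (M ℕ.+ i)) k) (binom i (R ∸ 1)) g)
             (+-cong (*-congʳ pascal-at-R)
                     (*-cong (trans (+-congʳ (sym (*-identityˡ g))) (sym (distribʳ g 1# ⌜ i ⌝)))
                             (reflexive (≡.cong (λ m → (x^ m) k) (≡.sym (≡.cong (_∸ 1) (ℕ.+-suc M i))))))))
    where
    pascal-at-R : binom i (R ∸ 1) + binom i R ≈ binom (suc i) R
    pascal-at-R = trans (+-congˡ (binom-≡ʳ i R≡1+[R-1])) (binom-≡ʳ (suc i) (≡.sym R≡1+[R-1]))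

  binomialAt-suc : ∀ i → BinomialBelow i → BinomialAt i → BinomialAt (suc i)
  binomialAt-suc i below at b b≡R = begin
    (αx *LA αpow i) b
      ≈⟨ αx-*LA (αpow i) b ⟩
    (x *L αpow i b) +L ((1⊗t *LA αpow i) b +L (deformation *LA αpow i) b)
      ≈⟨ +L-cong (*L-cong ≈L.refl (at b b≡R))
                 (+L-cong (1⊗t-*LA-suc (αpow i) b b′ (≡.trans b≡R (≡.trans R≡1+[R-1] (≡.cong suc (≡.sym b′≡R-1)))))
                          (deformation-*LA-at (αpow i) b b≡R)) ⟩
    (x *L (scale (binom i R) (x^ (i ∸ R)) +L scale (⌜ i ⌝ * g) (x^ (M ℕ.+ i ∸ 1))))
      +L (αpow i b′ +L (scale g (x^ M) *L αpow i 0F))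
      ≈⟨ +L-cong (≈L.trans (*L-distribˡ _ _ x) (+L-cong (x*L-binomialTerm i R) (x*L-x^[M+i-1] (⌜ i ⌝ * g) i)))
                 (+L-cong (below b′ b′≡R-1 (ℕ.∸-monoʳ-< {R} {1} {0} (s≤s z≤n) (ℕ.<⇒≤ 1<R)))
                          (≈L.trans (*L-cong ≈L.refl (below 0F toℕ-0F (ℕ.<-trans (s≤s z≤n) 1<R))) (g·x^M*L-x^i i))) ⟩
    (scale (binom i R) (x^ (suc i ∸ R)) +L scale (⌜ i ⌝ * g) (x^ (M ℕ.+ i)))
      +L (scale (binom i (R ∸ 1)) (x^ (i ∸ (R ∸ 1))) +L scale g (x^ (M ℕ.+ i)))
      ≈⟨ collect-at-R i ⟩
    scale (binom (suc i) R) (x^ (suc i ∸ R)) +L scale (⌜ suc i ⌝ * g) (x^ (M ℕ.+ suc i ∸ 1)) ∎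
    where
    b′ = fromℕ< (ℕ.≤-<-trans (ℕ.m∸n≤m R 1) R<N)
    b′≡R-1 = toℕ-fromℕ< (ℕ.≤-<-trans (ℕ.m∸n≤m R 1) R<N)

  αpow-binomial : ∀ i → BinomialBelow i × BinomialAt i
  αpow-binomial zero    = binomialBelow-zero , binomialAt-zero
  αpow-binomial (suc i) = binomialBelow-suc i below , binomialAt-suc i below at
    where
    below = proj₁ (αpow-binomial i)
    at    = proj₂ (αpow-binomial i)

  z-tA-≢ : ∀ j b → toℕ b ≢ j → z j (tA b) ≈ 0#
  z-tA-≢ j b b≢j = ΣK-zero N term
    where
    term : ∀ b′ → (if toℕ b′ ≡ᵇ j then tA b b′ else 0#) ≈ 0#
    term b′ with toℕ b′ ℕ.≟ j
    ... | no  b′≢j rewrite ≡ᵇ-false b′≢j = refl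
    ... | yes b′≡j rewrite ≡ᵇ-true b′≡j | ≡ᵇ-false {toℕ b′} {toℕ b} (λ b′≡b → b≢j (≡.trans (≡.sym b′≡b) b′≡j)) =
      refl

  z-tA-≡ : ∀ j b → toℕ b ≡ j → z j (tA b) ≈ 1#
  z-tA-≡ j b b≡j = ΣK-δ N j (≡.subst (_< N) b≡j (toℕ<n b)) miss hit
    where
    miss : ∀ b′ → toℕ b′ ≢ j → (if toℕ b′ ≡ᵇ j then tA b b′ else 0#) ≈ 0#
    miss b′ b′≢j rewrite ≡ᵇ-false b′≢j = refl
    hit : ∀ b′ → toℕ b′ ≡ j → (if toℕ b′ ≡ᵇ j then tA b b′ else 0#) ≈ 1#
    hit b′ b′≡j rewrite ≡ᵇ-true b′≡j | ≡ᵇ-true (≡.trans b′≡j (≡.sym b≡j)) = refl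

  act-z : ∀ j U b → toℕ b ≡ j → act (z j) U ≈L U b
  act-z j U b b≡j k = trans (reflexive (ΣL-pointwise N _ k))
    (ΣK-δ N j (≡.subst (_< N) b≡j (toℕ<n b))
      (λ b′ b′≢j → trans (*-congʳ (z-tA-≢ j b′ b′≢j)) (zeroˡ _))
      (λ b′ b′≡j → trans (*-congʳ (z-tA-≡ j b′ b′≡j))
                         (trans (*-identityˡ _)
                                (reflexive (≡.cong (λ b″ → U b″ k) (toℕ-injective (≡.trans b′≡j (≡.sym b≡j))))))))

  zx-below-R : ∀ i s → s < r → zx (p ^ s) i ≈L scale (binom i (p ^ s)) (x^ (i ∸ p ^ s))
  zx-below-R i s s<r = ≈L.trans (act-z (p ^ s) (αpow i) b b≡p^s) (proj₁ (αpow-binomial i) b b≡p^s p^s<R)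
    where
    p^s<R = ℕ.^-monoʳ-< p (s≤s 1≤q) s<r
    b = fromℕ< (ℕ.<-trans p^s<R R<N)
    b≡p^s = toℕ-fromℕ< (ℕ.<-trans p^s<R R<N)

  zx-at-R : ∀ i → zx R i ≈L (scale (binom i R) (x^ (i ∸ R)) +L scale (⌜ i ⌝ * g) (x^ (M ℕ.+ i ∸ 1)))
  zx-at-R i = ≈L.trans (act-z R (αpow i) b b≡R) (proj₂ (αpow-binomial i) b b≡R)
    where
    b = fromℕ< R<N
    b≡R = toℕ-fromℕ< R<N

module _ {a ℓ} (K : CommutativeRing a ℓ) (q n : ℕ) (p-prime : Prime (suc q)) (field-K : IsField K)
         (char-p : CommutativeRing._≈_ K (ℕ→K K (suc q)) (CommutativeRing.0# K)) (2≤n : 2 ≤ n)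
         (c cinv f : CommutativeRing.Carrier K) (inv : ℕ → CommutativeRing.Carrier K)
         (inv-spec : ∀ l → 1 ≤ l → l < suc q →
                     CommutativeRing._≈_ K (CommutativeRing._*_ K (inv l) (ℕ→K K ((l !) ℕ.* ((suc q ∸ l) !))))
                                           (CommutativeRing.1# K)) where
  open CommutativeRing K hiding (zero)
  open RingArithmetic K using (binom; binom->; ⌜_⌝; -‿distribˡ-*; -‿distribʳ-*; -1*x≈-x; -‿involutive)
  open CharacteristicP K q p-prime char-p using (1≤q; binom-p^s; wilson)
  open Coaction K q n c cinv f inv 1≤q 2≤n
  open Setup K (suc q) n c cinv f inv
  open ExtArithmetic K N c

  xpow-difference : ∀ {i m} → m ≤ i → xpow (+ i ℤ.- + m) ≡ x^ (i ∸ m)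
  xpow-difference {i} {m} m≤i = ≡.cong xpow (≡.trans (ℤ.[+m]-[+n]≡m⊖n i m) (ℤ.⊖-≥ m≤i))

  binomialTerm≈digitTerm : ∀ i s → scale (binom i (p ^ s)) (x^ (i ∸ p ^ s)) ≈L
                                   scale (⌜ digit p i s ⌝) (xpow (+ i ℤ.- + (p ^ s)))
  binomialTerm≈digitTerm i s with p ^ s ℕ.≤? i
  ... | yes p^s≤i = scale-cong (binom-p^s s i) (≈L.reflexive (≡.sym (xpow-difference p^s≤i)))
  ... | no  p^s≰i = ≈L.trans (vanishing (binom->  (ℕ.≰⇒> p^s≰i)))
                             (≈L.sym (vanishing (trans (sym (binom-p^s s i)) (binom-> (ℕ.≰⇒> p^s≰i)))))
    where
    vanishing : ∀ {α u} → α ≈ 0# → scale α u ≈L 0L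
    vanishing {u = u} α≈0 = ≈L.trans (scale-cong α≈0 ≈L.refl) (scale-zeroˡ u)

  inv[p-1]≈-1 : inv q ≈ - 1#
  inv[p-1]≈-1 = begin
    inv q                         ≈⟨ -‿involutive (inv q) ⟨
    - (- inv q)                   ≈⟨ -‿cong (-1*x≈-x (inv q)) ⟨
    - (- 1# * inv q)              ≈⟨ -‿cong (*-comm (- 1#) (inv q)) ⟩
    - (inv q * - 1#)              ≈⟨ -‿cong (*-congˡ (wilson field-K)) ⟨
    - (inv q * ⌜ q ! ⌝)           ≡⟨ ≡.cong (λ m → - (inv q * ⌜ m ⌝)) q!≡ ⟩
    - (inv q * ⌜ q ! ℕ.* (p ∸ q) ! ⌝) ≈⟨ -‿cong (inv-spec q 1≤q (ℕ.n<1+n q)) ⟩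
    - 1#                          ∎
    where
    open import Relation.Binary.Reasoning.Setoid setoid
    q!≡ : q ! ≡ q ! ℕ.* (p ∸ q) !
    q!≡ = ≡.trans (≡.sym (ℕ.*-identityʳ (q !))) (≡.cong (λ m → q ! ℕ.* m !) (≡.sym (ℕ.m+n∸n≡m 1 q)))

  deformationTerm≈-i·f-term : ∀ i → scale (⌜ i ⌝ * g) (x^ (M ℕ.+ i ∸ 1)) ≈L
                                    (-L scale (⌜ i ⌝ * f) (xpow (+ (M ℕ.+ i) ℤ.- + 1)))
  deformationTerm≈-i·f-term i k =
    trans (*-cong coefficient (reflexive (≡.cong (λ u → u k) (≡.sym (xpow-difference 1≤M+i)))))
          (sym (-‿distribˡ-* _ _))
    where
    1≤M+i = ℕ.≤-trans 1≤M (ℕ.m≤m+n M i)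
    coefficient : ⌜ i ⌝ * g ≈ - (⌜ i ⌝ * f)
    coefficient = trans (*-congˡ (trans (*-congˡ inv[p-1]≈-1) (trans (*-comm f _) (-1*x≈-x f))))
                        (sym (-‿distribʳ-* _ _))

  z-on-powers : ∀ i →
    (∀ s → s < r → zx (p ^ s) i ≈L scale (⌜ digit p i s ⌝) (xpow (+ i ℤ.- + (p ^ s)))) ×
    (zx (p ^ r) i ≈L (scale (⌜ digit p i r ⌝) (xpow (+ i ℤ.- + (p ^ r)))
                       -L scale (⌜ i ⌝ * f) (xpow (+ (p ^ r ℕ.* (p ∸ 1) ℕ.+ i) ℤ.- + 1))))
  z-on-powers i = (λ s s<r → ≈L.trans (zx-below-R i s s<r) (binomialTerm≈digitTerm i s))
                , ≈L.trans (zx-at-R i) (+L-cong (binomialTerm≈digitTerm i r) (deformationTerm≈-i·f-term i))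

theorem5p9 : ∀ {a ℓ} (K : CommutativeRing a ℓ) →
    let open CommutativeRing K in
    (p n : ℕ) → Prime p → IsField K → ℕ→K K p ≈ 0# → 2 ≤ n →
    (f : Carrier) → ¬ f ≈ 0# →
    (c cinv : Carrier) → c * cinv ≈ 1# → Ext.LIsField K (p ^ n) c →
    (inv : ℕ → Carrier) →
    (∀ l → 1 ≤ l → l < p → inv l * ℕ→K K ((l !) ℕ.* ((p ∸ l) !)) ≈ 1#) →
    let open Setup K p n c cinv f inv in
    (i : ℕ) → i < p ^ n →
    (∀ s → s < r →
      zx (p ^ s) i ≈L scale (ℕ→K K (digit p i s)) (xpow (+ i ℤ.- + (p ^ s))))
    ×
    (zx (p ^ r) i ≈L
      (scale (ℕ→K K (digit p i r)) (xpow (+ i ℤ.- + (p ^ r)))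
        -L scale (ℕ→K K i * f) (xpow (+ (p ^ r ℕ.* (p ∸ 1) ℕ.+ i) ℤ.- + 1))))
theorem5p9 K zero    n p-prime = ⊥-elim (¬prime[0] p-prime)
theorem5p9 K (suc q) n p-prime field-K char-p 2≤n f _ c cinv _ _ inv inv-spec i _ =
  z-on-powers K q n p-prime field-K char-p 2≤n c cinv f inv inv-spec i
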